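{- Let $A$ be a $2$-elementary form which contains (as an orthogonal direct summand) a form isometric to $U$. Then $G(A,\mathrm{O}(A))=\delta_A\sqrt{|A|}$ if $A$ is special, and $G(A,\mathrm{O}(A))=0$ if $A$ is non-special.
   Context: A finite quadratic form is a finite abelian group $A$ with $q:A\to\mathbb{Q}/\mathbb{Z}$ such that $q(nx)=n^2q(x)$ and $(x,y):=q(x+y)-q(x)-q(y)$ is a nondegenerate symmetric bilinear form; $\mathrm{O}(A)$ is its isometry group, $e(z)=\exp(2\pi iz)$, and $G(A,\Gamma)=\sum_{[x]\in\Gamma\backslash A}\sum_{y\in\Gamma x}e((x,y))$. A $2$-elementary form is such a form on an elementary abelian $2$-group. The norm of $x$ is $(x,x)=2q(x)\in\mathbb{Q}/2\mathbb{Z}$. $U$ (resp. $V$) is the form on $(\mathbb{Z}/2)^2$ with basis $u_1,u_2$ such that $q(u_1)=q(u_2)=0$ (resp. $q(u_1)=q(u_2)=1/2$) and $(u_1,u_2)=1/2$. The characteristic element $x_A$ is the unique element with $(x,x_A)\equiv(x,x)\bmod\mathbb{Z}$ for all $x$; $A$ is special if $x_A=0$. A special form is isometric to $U^n$ or to $U^{n-1}\oplus V$; set $\delta_A=1$ in the first case and $\delta_A=-1$ in the second. -}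

module Defs where

open import Data.Bool using (Bool; true; false; _xor_)
open import Data.Nat using (ℕ; zero; suc; _+_; _*_)
open import Data.Integer as ℤ using (ℤ; +_; -[1+_])
open import Data.Product using (Σ; _×_; _,_; proj₁; proj₂)
open import Data.List using (List; []; _∷_; _++_; map)
open import Data.List.Relation.Unary.Any using (any?)
open import Data.Vec using (Vec; []; _∷_; zipWith; replicate; take; drop)
open import Relation.Nullary using (Dec; yes; no; ¬_)
open import Relation.Binary.PropositionalEquality using (_≡_)

-- ℤ/4ℤ, read as the subgroup (1/4)ℤ/ℤ of ℚ/ℤ : zk stands for k/4.

data Z4 : Set where
  z0 z1 z2 z3 : Z4

suc₄ : Z4 → Z4
suc₄ z0 = z1
suc₄ z1 = z2
suc₄ z2 = z3
suc₄ z3 = z0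

_+₄_ : Z4 → Z4 → Z4
z0 +₄ b = b
z1 +₄ b = suc₄ b
z2 +₄ b = suc₄ (suc₄ b)
z3 +₄ b = suc₄ (suc₄ (suc₄ b))

-₄_ : Z4 → Z4
-₄ z0 = z0
-₄ z1 = z3
-₄ z2 = z2
-₄ z3 = z1

_-₄_ : Z4 → Z4 → Z4
a -₄ b = a +₄ (-₄ b)

_·₄_ : ℕ → Z4 → Z4
zero ·₄ a = z0
suc k ·₄ a = a +₄ (k ·₄ a)

El : ℕ → Set
El n = Vec Bool n

_⊕v_ : ∀ {n} → El n → El n → El n
_⊕v_ = zipWith _xor_

0v : ∀ {n} → El n
0v = replicate _ false

_·v_ : ∀ {n} → ℕ → El n → El n
zero ·v x = 0v
suc k ·v x = x ⊕v (k ·v x)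

allEl : (n : ℕ) → List (El n)
allEl zero = [] ∷ []
allEl (suc n) = map (false ∷_) (allEl n) ++ map (true ∷_) (allEl n)

QuadFn : ℕ → Set
QuadFn n = El n → Z4

bil : ∀ {n} → QuadFn n → El n → El n → Z4
bil q x y = (q (x ⊕v y) -₄ q x) -₄ q y

record IsFQF {n : ℕ} (q : QuadFn n) : Set where
  field
    scale   : ∀ (k : ℕ) (x : El n) → q (k ·v x) ≡ (k * k) ·₄ q x
    linˡ    : ∀ x y z → bil q (x ⊕v y) z ≡ bil q x z +₄ bil q y z
    linʳ    : ∀ x y z → bil q x (y ⊕v z) ≡ bil q x y +₄ bil q x z
    symm    : ∀ x y → bil q x y ≡ bil q y x
    nondeg  : ∀ x → (∀ y → bil q x y ≡ z0) → x ≡ 0v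

record Isometry {n k : ℕ} (qA : QuadFn n) (qB : QuadFn k) : Set where
  field
    fun      : El n → El k
    inv      : El k → El n
    inv-fun  : ∀ x → inv (fun x) ≡ x
    fun-inv  : ∀ y → fun (inv y) ≡ y
    additive : ∀ x y → fun (x ⊕v y) ≡ fun x ⊕v fun y
    preserve : ∀ x → qB (fun x) ≡ qA x
open Isometry public

_⊕q_ : ∀ {n k} → QuadFn n → QuadFn k → QuadFn (n + k)
_⊕q_ {n} qA qB v = qA (take n v) +₄ qB (drop n v)

qU : QuadFn 2
qU (false ∷ false ∷ []) = z0
qU (true ∷ false ∷ []) = z0
qU (false ∷ true ∷ []) = z0
qU (true ∷ true ∷ []) = z2

qV : QuadFn 2
qV (false ∷ false ∷ []) = z0
qV (true ∷ false ∷ []) = z2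
qV (false ∷ true ∷ []) = z2
qV (true ∷ true ∷ []) = z2

dbl : ℕ → ℕ
dbl zero = zero
dbl (suc m) = suc (suc (dbl m))

Upow : (m : ℕ) → QuadFn (dbl m)
Upow zero = λ _ → z0
Upow (suc m) = qU ⊕q Upow m

ContainsU : ∀ {n} → QuadFn n → Set
ContainsU {n} q = Σ ℕ λ k → Σ (QuadFn k) λ qB → IsFQF qB × Isometry q (qU ⊕q qB)

-- characteristic element: (x, c) ≡ (x, x) mod ℤ for all x.
-- In Z4 units, (x,x) = 2q(x) ∈ ℚ/2ℤ reduces mod ℤ to 2·q(x) ∈ ℚ/ℤ.
IsCharacteristic : ∀ {n} → QuadFn n → El n → Set
IsCharacteristic q c = ∀ x → bil q x c ≡ 2 ·₄ q x

Special : ∀ {n} → QuadFn n → Set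
Special q = IsCharacteristic q 0v

Orbit : ∀ {n} → QuadFn n → El n → El n → Set
Orbit q x y = Σ (Isometry q q) λ g → fun g x ≡ y

ℤi : Set
ℤi = ℤ × ℤ

_+i_ : ℤi → ℤi → ℤi
(a , b) +i (c , d) = (a ℤ.+ c , b ℤ.+ d)

0i : ℤi
0i = (+ 0 , + 0)

-- e(k/4) = i^k
e : Z4 → ℤi
e z0 = (+ 1 , + 0)
e z1 = (+ 0 , + 1)
e z2 = (-[1+ 0 ] , + 0)
e z3 = (+ 0 , -[1+ 0 ])

module _ {n : ℕ} (q : QuadFn n) (orb? : ∀ x y → Dec (Orbit q x y)) where

  orbitSum : El n → ℤi
  orbitSum x = go (allEl n)
    where
    go : List (El n) → ℤi
    go [] = 0i
    go (y ∷ ys) with orb? x y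
    ... | yes _ = e (bil q x y) +i go ys
    ... | no _ = go ys

  repsGo : List (El n) → List (El n) → List (El n)
  repsGo seen [] = []
  repsGo seen (x ∷ xs) with any? (λ z → orb? z x) seen
  ... | yes _ = repsGo seen xs
  ... | no _ = x ∷ repsGo (x ∷ seen) xs

  sumOver : List (El n) → ℤi
  sumOver [] = 0i
  sumOver (x ∷ xs) = orbitSum x +i sumOver xs

  G : ℤi
  G = sumOver (repsGo [] (allEl n))

{-# OPTIONS --safe #-}
module Submission where

-- Write A = U ⊕ B with a hyperbolic pair u₁, u₂ spanning U. Transvections and Eichler
-- transformations show that O(A) acts transitively on the generic vectors (nonzero, not characteristic)
-- of a given norm; the remaining orbits are {0} and {c} for a nonzero characteristic c. Hence
-- G(A, O(A)) is the sum, over one generic vector g per value of q, of Σ_{q(y) = q(g)} e((g, y)), the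
-- non-generic y contributing exactly the orbit sums of {0} and {c}. Expanding the indicator of q(y) = q(g)
-- in characters of ℤ/4, four times such a sum is e(2q(g)) (γ + γ₃) with γ = Σ e(q(y)), γ₃ = Σ e(3q(y)).
-- If A is special, q only takes the values 0 and 1/2 and γ₃ = γ, so G = γ, which is computed on U^m and
-- U^m ⊕ V; otherwise all four values occur, with signs e(2q(g)) = 1, 1, -1, -1, and G = 0.

open import Defs
open import Algebra.Bundles using (AbelianGroup; CommutativeSemigroup)
open import Level using (0ℓ)
open import Data.Bool using (Bool; true; false; T; _xor_; _∧_; _∨_; if_then_else_)
open import Data.Bool.Properties using (xor-comm; xor-assoc; xor-same)
import Data.Bool.Properties as Bool
open import Data.Empty using (⊥-elim)
open import Data.Fin using (Fin; zero; suc)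
open import Data.Integer as ℤ using (ℤ; +_; -_)
import Data.Integer.Properties as ℤ
open import Data.List using (List; []; _∷_; _++_; map; filter)
open import Data.List.Membership.Propositional using (_∈_; lose)
open import Data.List.Membership.Propositional.Properties using (∈-map⁺; ∈-++⁺ˡ; ∈-++⁺ʳ)
open import Data.List.Relation.Unary.All using (All; []; _∷_)
open import Data.List.Relation.Unary.Any as Any using (Any; any?; here; there; satisfied)
open import Data.Nat using (ℕ; zero; suc; _+_; _*_; _^_)
import Data.Nat.Properties as ℕ
open import Data.Product using (Σ; _×_; _,_; proj₁; proj₂; ∃)
open import Data.Product.Properties using (≡-dec)
open import Data.Sum using (_⊎_; inj₁; inj₂)
open import Data.Vec using ([]; _∷_; take; drop)
import Data.Vec.Properties as Vec
open import Relation.Binary.Definitions using (DecidableEquality)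
open import Relation.Binary.PropositionalEquality
open import Relation.Nullary using (Dec; yes; no; ¬_)
open import Relation.Nullary.Decidable using (True; toWitness; map′; _×-dec_; _→-dec_; ¬?; T?; decidable-stable)

cong₃ : ∀ {A B C D : Set} (f : A → B → C → D) {a a' b b' c c'} →
        a ≡ a' → b ≡ b' → c ≡ c' → f a b c ≡ f a' b' c'
cong₃ f refl refl refl = refl

decide : {A : Set} (a? : Dec A) {_ : True a?} → A
decide a? {p} = toWitness p

∀₄? : {P : Z4 → Set} → (∀ a → Dec (P a)) → Dec (∀ a → P a)
∀₄? P? = map′ (λ { (p0 , p1 , p2 , p3) → λ { z0 → p0 ; z1 → p1 ; z2 → p2 ; z3 → p3 } })
              (λ h → h z0 , h z1 , h z2 , h z3)
              (P? z0 ×-dec P? z1 ×-dec P? z2 ×-dec P? z3)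

∀ᵇ? : {P : Bool → Set} → (∀ a → Dec (P a)) → Dec (∀ a → P a)
∀ᵇ? P? = map′ (λ { (p0 , p1) → λ { false → p0 ; true → p1 } })
              (λ h → h false , h true)
              (P? false ×-dec P? true)

infix 4 _≟₄_
_≟₄_ : DecidableEquality Z4
z0 ≟₄ z0 = yes refl
z1 ≟₄ z1 = yes refl
z2 ≟₄ z2 = yes refl
z3 ≟₄ z3 = yes refl
z0 ≟₄ z1 = no λ ()
z0 ≟₄ z2 = no λ ()
z0 ≟₄ z3 = no λ ()
z1 ≟₄ z0 = no λ ()
z1 ≟₄ z2 = no λ ()
z1 ≟₄ z3 = no λ ()
z2 ≟₄ z0 = no λ ()
z2 ≟₄ z1 = no λ ()
z2 ≟₄ z3 = no λ ()
z3 ≟₄ z0 = no λ ()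
z3 ≟₄ z1 = no λ ()
z3 ≟₄ z2 = no λ ()

+₄-identityʳ : ∀ a → a +₄ z0 ≡ a
+₄-identityʳ = decide (∀₄? λ a → _ ≟₄ _)

+₄-cancel : ∀ s a b → (a +₄ b) +₄ ((s -₄ a) -₄ b) ≡ s
+₄-cancel = decide (∀₄? λ s → ∀₄? λ a → ∀₄? λ b → _ ≟₄ _)

data Even : Z4 → Set where
  even0 : Even z0
  even2 : Even z2

even? : ∀ a → Dec (Even a)
even? z0 = yes even0
even? z1 = no λ ()
even? z2 = yes even2
even? z3 = no λ ()

Odd : Z4 → Set
Odd a = ¬ Even a

odd? : ∀ a → Dec (Odd a)
odd? a = ¬? (even? a)

even-+₄-self : ∀ a → a +₄ a ≡ z0 → Even a
even-+₄-self = decide (∀₄? λ a → (_ ≟₄ _) →-dec even? a)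

-- Identifies (1/2)ℤ/ℤ with ℤ/2; odd elements are sent to false.
bit : Z4 → Bool
bit z2 = true
bit _ = false

infix 21 _•₄_
_•₄_ : Bool → Z4 → Z4
b •₄ a = if b then a else z0

even-bit : ∀ a → Even a → a ≡ bit a •₄ z2
even-bit = decide (∀₄? λ a → even? a →-dec (a ≟₄ bit a •₄ z2))

even-if-2·₄-zero : ∀ a → 2 ·₄ a ≡ z0 → Even a
even-if-2·₄-zero = decide (∀₄? λ a → (2 ·₄ a ≟₄ z0) →-dec even? a)

2·₄-even-zero : ∀ a → Even a → 2 ·₄ a ≡ z0
2·₄-even-zero = decide (∀₄? λ a → even? a →-dec (2 ·₄ a ≟₄ z0))

bit-+₄ : ∀ a b → Even a → Even b → bit (a +₄ b) ≡ bit a xor bit b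
bit-+₄ = decide (∀₄? λ a → ∀₄? λ b → even? a →-dec even? b →-dec (bit _ Bool.≟ _))

⊕-comm : ∀ {n} (x y : El n) → x ⊕v y ≡ y ⊕v x
⊕-comm [] [] = refl
⊕-comm (a ∷ x) (b ∷ y) = cong₂ _∷_ (xor-comm a b) (⊕-comm x y)

⊕-assoc : ∀ {n} (x y z : El n) → (x ⊕v y) ⊕v z ≡ x ⊕v (y ⊕v z)
⊕-assoc [] [] [] = refl
⊕-assoc (a ∷ x) (b ∷ y) (c ∷ z) = cong₂ _∷_ (xor-assoc a b c) (⊕-assoc x y z)

⊕-identityˡ : ∀ {n} (x : El n) → 0v ⊕v x ≡ x
⊕-identityˡ [] = refl
⊕-identityˡ (a ∷ x) = cong (a ∷_) (⊕-identityˡ x)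

⊕-identityʳ : ∀ {n} (x : El n) → x ⊕v 0v ≡ x
⊕-identityʳ x = trans (⊕-comm x 0v) (⊕-identityˡ x)

⊕-self : ∀ {n} (x : El n) → x ⊕v x ≡ 0v
⊕-self [] = refl
⊕-self (a ∷ x) = cong₂ _∷_ (xor-same a) (⊕-self x)

⊕-cancelʳ : ∀ {n} (x v : El n) → (x ⊕v v) ⊕v v ≡ x
⊕-cancelʳ x v = trans (⊕-assoc x v v) (trans (cong (x ⊕v_) (⊕-self v)) (⊕-identityʳ x))

⊕-commutativeSemigroup : ℕ → CommutativeSemigroup 0ℓ 0ℓ
⊕-commutativeSemigroup n = record
  { Carrier = El n
  ; _≈_ = _≡_
  ; _∙_ = _⊕v_
  ; isCommutativeSemigroup = record
    { isSemigroup = record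
      { isMagma = record { isEquivalence = isEquivalence ; ∙-cong = cong₂ _⊕v_ }
      ; assoc = ⊕-assoc }
    ; comm = ⊕-comm } }

⊕-interchange : ∀ {n} (a b c d : El n) → (a ⊕v b) ⊕v (c ⊕v d) ≡ (a ⊕v c) ⊕v (b ⊕v d)
⊕-interchange {n} = interchange
  where open import Algebra.Properties.CommutativeSemigroup (⊕-commutativeSemigroup n)

_≟v_ : ∀ {n} → DecidableEquality (El n)
_≟v_ = Vec.≡-dec Bool._≟_

infix 21 _•_
_•_ : ∀ {n} → Bool → El n → El n
true • v = v
false • v = 0v

•-distrib-xor : ∀ {n} a b (v : El n) → (a xor b) • v ≡ a • v ⊕v b • v
•-distrib-xor false b v = sym (⊕-identityˡ _)
•-distrib-xor true false v = sym (⊕-identityʳ _)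
•-distrib-xor true true v = sym (⊕-self v)

∀v? : ∀ {n} {P : El n → Set} → (∀ x → Dec (P x)) → Dec (∀ x → P x)
∀v? {zero} P? = map′ (λ p → λ { [] → p }) (λ h → h []) (P? [])
∀v? {suc n} P? = map′ (λ { (f , t) → λ { (false ∷ x) → f x ; (true ∷ x) → t x } })
                      (λ h → (λ x → h (false ∷ x)) , (λ x → h (true ∷ x)))
                      (∀v? (λ x → P? (false ∷ x)) ×-dec ∀v? (λ x → P? (true ∷ x)))

¬∀⇒∃¬ : ∀ {n} {P : El n → Set} → (∀ x → Dec (P x)) → ¬ (∀ x → P x) → ∃ λ x → ¬ P x
¬∀⇒∃¬ {zero} P? ¬all = [] , λ p → ¬all λ { [] → p }
¬∀⇒∃¬ {suc n} P? ¬all with ∀v? (λ x → P? (false ∷ x))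
... | no ¬f = let (x , ¬p) = ¬∀⇒∃¬ (λ x → P? (false ∷ x)) ¬f in false ∷ x , ¬p
... | yes f = let (x , ¬p) = ¬∀⇒∃¬ (λ x → P? (true ∷ x))
                                   (λ t → ¬all λ { (false ∷ x) → f x ; (true ∷ x) → t x })
              in true ∷ x , ¬p

Generic : ∀ {n} → QuadFn n → El n → Set
Generic q x = (¬ x ≡ 0v) × ¬ IsCharacteristic q x

module FQF {n : ℕ} {q : QuadFn n} (F : IsFQF q) where
  open IsFQF F public

  q-0v : q 0v ≡ z0
  q-0v = scale 0 0v

  q-⊕ : ∀ x y → q (x ⊕v y) ≡ (q x +₄ q y) +₄ bil q x y
  q-⊕ x y = sym (+₄-cancel (q (x ⊕v y)) (q x) (q y))

  bil-0ʳ : ∀ x → bil q x 0v ≡ z0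
  bil-0ʳ x rewrite ⊕-identityʳ x | q-0v = decide (∀₄? λ a → (a -₄ a) -₄ z0 ≟₄ z0) (q x)

  bil-0ˡ : ∀ x → bil q 0v x ≡ z0
  bil-0ˡ x = trans (symm 0v x) (bil-0ʳ x)

  bil-even : ∀ x y → Even (bil q x y)
  bil-even x y = even-+₄-self _ (begin
    bil q x y +₄ bil q x y ≡⟨ linʳ x y y ⟨
    bil q x (y ⊕v y)       ≡⟨ cong (bil q x) (⊕-self y) ⟩
    bil q x 0v             ≡⟨ bil-0ʳ x ⟩
    z0                     ∎)
    where open ≡-Reasoning

  bil-self : ∀ x → bil q x x ≡ 2 ·₄ q x
  bil-self x rewrite ⊕-self x | q-0v = decide (∀₄? λ a → (z0 -₄ a) -₄ a ≟₄ 2 ·₄ a) (q x)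

  bil-•ʳ : ∀ b x v → bil q x (b • v) ≡ b •₄ bil q x v
  bil-•ʳ true x v = refl
  bil-•ʳ false x v = bil-0ʳ x

  bil-•ˡ : ∀ b v x → bil q (b • v) x ≡ b •₄ bil q v x
  bil-•ˡ true v x = refl
  bil-•ˡ false v x = bil-0ˡ x

  q-• : ∀ b v → q (b • v) ≡ b •₄ q v
  q-• true v = refl
  q-• false v = q-0v

  bilᵇ : El n → El n → Bool
  bilᵇ x v = bit (bil q x v)

  bilᵇ-⊕ˡ : ∀ x y v → bilᵇ (x ⊕v y) v ≡ bilᵇ x v xor bilᵇ y v
  bilᵇ-⊕ˡ x y v = trans (cong bit (linˡ x y v)) (bit-+₄ _ _ (bil-even x v) (bil-even y v))

  bil-bilᵇ : ∀ x v → bil q x v ≡ bilᵇ x v •₄ z2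
  bil-bilᵇ x v = even-bit (bil q x v) (bil-even x v)

  nondeg-witness : ∀ x → ¬ x ≡ 0v → ∃ λ y → bil q x y ≡ z2
  nondeg-witness x x≢0 =
    let (y , ¬bil≡0) = ¬∀⇒∃¬ (λ y → bil q x y ≟₄ z0) (λ all → x≢0 (nondeg x all))
    in y , decide (∀₄? λ a → even? a →-dec ¬? (a ≟₄ z0) →-dec (a ≟₄ z2)) _ (bil-even x y) ¬bil≡0

  isCharacteristic? : ∀ c → Dec (IsCharacteristic q c)
  isCharacteristic? c = ∀v? (λ x → bil q x c ≟₄ 2 ·₄ q x)

  noncharacteristic-witness : ∀ c → ¬ IsCharacteristic q c → ∃ λ a → ¬ bil q a c ≡ 2 ·₄ q a
  noncharacteristic-witness c = ¬∀⇒∃¬ (λ x → bil q x c ≟₄ 2 ·₄ q x)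

  generic? : ∀ x → Dec (Generic q x)
  generic? x = ¬? (x ≟v 0v) ×-dec ¬? (isCharacteristic? x)

  generic-if-paired : ∀ {u x} → q u ≡ z0 → bil q u x ≡ z2 → Generic q x
  generic-if-paired {u} {x} q-u bil-ux = x≢0 , x-nonchar
    where
    z2≢z0 : ¬ z2 ≡ z0
    z2≢z0 ()
    x≢0 : ¬ x ≡ 0v
    x≢0 refl = z2≢z0 (trans (sym bil-ux) (bil-0ʳ u))
    x-nonchar : ¬ IsCharacteristic q x
    x-nonchar hx = z2≢z0 (trans (sym bil-ux) (trans (hx u) (cong (2 ·₄_) q-u)))

  characteristic-unique : ∀ {c c'} → IsCharacteristic q c → IsCharacteristic q c' → c ≡ c'
  characteristic-unique {c} {c'} hc hc' = begin
    c                ≡⟨ ⊕-cancelʳ c c' ⟨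
    (c ⊕v c') ⊕v c'  ≡⟨ cong (_⊕v c') (nondeg (c ⊕v c') bil-c⊕c') ⟩
    0v ⊕v c'         ≡⟨ ⊕-identityˡ c' ⟩
    c'               ∎
    where
    open ≡-Reasoning
    bil-c⊕c' : ∀ y → bil q (c ⊕v c') y ≡ z0
    bil-c⊕c' y = begin
      bil q (c ⊕v c') y              ≡⟨ symm _ y ⟩
      bil q y (c ⊕v c')              ≡⟨ linʳ y c c' ⟩
      bil q y c +₄ bil q y c'        ≡⟨ cong₂ _+₄_ (hc y) (hc' y) ⟩
      (2 ·₄ q y) +₄ (2 ·₄ q y)       ≡⟨ decide (∀₄? λ a → (2 ·₄ a) +₄ (2 ·₄ a) ≟₄ z0) (q y) ⟩
      z0                             ∎

module _ {n k : ℕ} {q₁ : QuadFn n} {q₂ : QuadFn k} (g : Isometry q₁ q₂) where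
  open ≡-Reasoning

  fun-0v : fun g 0v ≡ 0v
  fun-0v = begin
    fun g 0v             ≡⟨ cong (fun g) (⊕-self 0v) ⟨
    fun g (0v ⊕v 0v)     ≡⟨ additive g 0v 0v ⟩
    fun g 0v ⊕v fun g 0v ≡⟨ ⊕-self _ ⟩
    0v                   ∎

  bil-fun : ∀ x y → bil q₂ (fun g x) (fun g y) ≡ bil q₁ x y
  bil-fun x y = begin
    (q₂ (fun g x ⊕v fun g y) -₄ q₂ (fun g x)) -₄ q₂ (fun g y)
      ≡⟨ cong (λ t → (q₂ t -₄ q₂ (fun g x)) -₄ q₂ (fun g y)) (additive g x y) ⟨
    (q₂ (fun g (x ⊕v y)) -₄ q₂ (fun g x)) -₄ q₂ (fun g y)
      ≡⟨ cong₂ (λ s t → (s -₄ t) -₄ q₂ (fun g y)) (preserve g (x ⊕v y)) (preserve g x) ⟩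
    (q₁ (x ⊕v y) -₄ q₁ x) -₄ q₂ (fun g y)
      ≡⟨ cong (λ t → (q₁ (x ⊕v y) -₄ q₁ x) -₄ t) (preserve g y) ⟩
    bil q₁ x y ∎

  inv-⊕ : ∀ x y → inv g (x ⊕v y) ≡ inv g x ⊕v inv g y
  inv-⊕ x y = begin
    inv g (x ⊕v y)                             ≡⟨ cong₂ (λ s t → inv g (s ⊕v t)) (fun-inv g x) (fun-inv g y) ⟨
    inv g (fun g (inv g x) ⊕v fun g (inv g y)) ≡⟨ cong (inv g) (additive g _ _) ⟨
    inv g (fun g (inv g x ⊕v inv g y))         ≡⟨ inv-fun g _ ⟩
    inv g x ⊕v inv g y                         ∎

  q-inv : ∀ y → q₁ (inv g y) ≡ q₂ y
  q-inv y = trans (sym (preserve g (inv g y))) (cong q₂ (fun-inv g y))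

  isometry⁻¹ : Isometry q₂ q₁
  isometry⁻¹ = record { fun = inv g ; inv = fun g ; inv-fun = fun-inv g ; fun-inv = inv-fun g
                      ; additive = inv-⊕ ; preserve = q-inv }

isometry-id : ∀ {n} {q : QuadFn n} → Isometry q q
isometry-id = record { fun = λ x → x ; inv = λ x → x ; inv-fun = λ _ → refl ; fun-inv = λ _ → refl
                     ; additive = λ _ _ → refl ; preserve = λ _ → refl }

_⨾_ : ∀ {n k l} {q₁ : QuadFn n} {q₂ : QuadFn k} {q₃ : QuadFn l} →
      Isometry q₁ q₂ → Isometry q₂ q₃ → Isometry q₁ q₃
g ⨾ h = record
  { fun = λ x → fun h (fun g x)
  ; inv = λ z → inv g (inv h z)
  ; inv-fun = λ x → trans (cong (inv g) (inv-fun h (fun g x))) (inv-fun g x)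
  ; fun-inv = λ z → trans (cong (fun h) (fun-inv g (inv h z))) (fun-inv h z)
  ; additive = λ x y → trans (cong (fun h) (additive g x y)) (additive h _ _)
  ; preserve = λ x → trans (preserve h (fun g x)) (preserve g x) }

module _ {n : ℕ} {q : QuadFn n} where

  orbit-refl : ∀ {x} → Orbit q x x
  orbit-refl = isometry-id , refl

  orbit-sym : ∀ {x y} → Orbit q x y → Orbit q y x
  orbit-sym {x} (g , refl) = isometry⁻¹ g , inv-fun g x

  orbit-trans : ∀ {x y z} → Orbit q x y → Orbit q y z → Orbit q x z
  orbit-trans (g , refl) (h , refl) = g ⨾ h , refl

  orbit-q : ∀ {x y} → Orbit q x y → q x ≡ q y
  orbit-q (g , refl) = sym (preserve g _)

  orbit-0v : ∀ {y} → Orbit q 0v y → y ≡ 0v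
  orbit-0v (g , refl) = fun-0v g

  orbit-characteristic : ∀ {c y} → Orbit q c y → IsCharacteristic q c → IsCharacteristic q y
  orbit-characteristic {c} (g , refl) hc a = begin
    bil q a (fun g c)                 ≡⟨ cong (λ t → bil q t (fun g c)) (fun-inv g a) ⟨
    bil q (fun g (inv g a)) (fun g c) ≡⟨ bil-fun g (inv g a) c ⟩
    bil q (inv g a) c                 ≡⟨ hc (inv g a) ⟩
    2 ·₄ q (inv g a)                  ≡⟨ cong (2 ·₄_) (q-inv g a) ⟩
    2 ·₄ q a                          ∎
    where open ≡-Reasoning

  orbit-generic : ∀ {x y} → Orbit q x y → Generic q x → Generic q y
  orbit-generic x~y (x≢0 , x-nonchar) =
    (λ { refl → x≢0 (orbit-0v (orbit-sym x~y)) }) , (λ hy → x-nonchar (orbit-characteristic (orbit-sym x~y) hy))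

-- x ↦ x + L x is its own inverse because L ∘ L = 0.
shift-isometry : ∀ {n} {q : QuadFn n} (L : El n → El n) →
  (∀ x y → L (x ⊕v y) ≡ L x ⊕v L y) → (∀ x → L (L x) ≡ 0v) →
  (∀ x → q (x ⊕v L x) ≡ q x) → Isometry q q
shift-isometry {n} {q} L L-⊕ L-L q-shift = record
  { fun = shift ; inv = shift ; inv-fun = shift-shift ; fun-inv = shift-shift
  ; additive = shift-⊕ ; preserve = q-shift }
  where
  open ≡-Reasoning
  shift : El n → El n
  shift x = x ⊕v L x

  shift-⊕ : ∀ x y → shift (x ⊕v y) ≡ shift x ⊕v shift y
  shift-⊕ x y = trans (cong ((x ⊕v y) ⊕v_) (L-⊕ x y)) (⊕-interchange x y (L x) (L y))

  shift-shift : ∀ x → shift (shift x) ≡ x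
  shift-shift x = begin
    (x ⊕v L x) ⊕v L (x ⊕v L x)      ≡⟨ cong ((x ⊕v L x) ⊕v_) (L-⊕ x (L x)) ⟩
    (x ⊕v L x) ⊕v (L x ⊕v L (L x))  ≡⟨ cong (λ t → (x ⊕v L x) ⊕v (L x ⊕v t)) (L-L x) ⟩
    (x ⊕v L x) ⊕v (L x ⊕v 0v)       ≡⟨ cong ((x ⊕v L x) ⊕v_) (⊕-identityʳ (L x)) ⟩
    (x ⊕v L x) ⊕v L x               ≡⟨ ⊕-cancelʳ x (L x) ⟩
    x                               ∎

module ElementaryIsometries {n : ℕ} {q : QuadFn n} (F : IsFQF q) where
  open FQF F
  open ≡-Reasoning

  •-⊕ : ∀ (c : El n → Bool) → (∀ x y → c (x ⊕v y) ≡ c x xor c y) → ∀ (v : El n) x y →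
        c (x ⊕v y) • v ≡ c x • v ⊕v c y • v
  •-⊕ c c-⊕ v x y = trans (cong (_• v) (c-⊕ x y)) (•-distrib-xor (c x) (c y) v)

  transvection : ∀ v → q v ≡ z2 → Isometry q q
  transvection v hv = shift-isometry L L-⊕ L-L q-shift
    where
    L : El n → El n
    L x = bilᵇ x v • v

    L-⊕ : ∀ x y → L (x ⊕v y) ≡ L x ⊕v L y
    L-⊕ = •-⊕ (λ x → bilᵇ x v) (λ x y → bilᵇ-⊕ˡ x y v) v

    L-L : ∀ x → L (L x) ≡ 0v
    L-L x = cong (λ t → bit t • v)
      (trans (bil-•ˡ (bilᵇ x v) v v)
        (trans (cong (bilᵇ x v •₄_) (trans (bil-self v) (cong (2 ·₄_) hv))) (Bool.if-eta (bilᵇ x v))))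

    q-shift : ∀ x → q (x ⊕v L x) ≡ q x
    q-shift x = begin
      q (x ⊕v c • v)
        ≡⟨ q-⊕ x (c • v) ⟩
      (q x +₄ q (c • v)) +₄ bil q x (c • v)
        ≡⟨ cong₂ (λ s t → (q x +₄ s) +₄ t) (q-• c v) (bil-•ʳ c x v) ⟩
      (q x +₄ c •₄ q v) +₄ c •₄ bil q x v
        ≡⟨ cong₂ (λ s t → (q x +₄ c •₄ s) +₄ c •₄ t) hv (bil-bilᵇ x v) ⟩
      (q x +₄ c •₄ z2) +₄ c •₄ (c •₄ z2)
        ≡⟨ decide (∀₄? λ a → ∀ᵇ? λ b → (a +₄ b •₄ z2) +₄ b •₄ (b •₄ z2) ≟₄ a) (q x) c ⟩
      q x ∎
      where
      c : Bool
      c = bilᵇ x v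

  eichler : ∀ e b → q e ≡ z0 → bil q b e ≡ z0 → Even (q b) → Isometry q q
  eichler e b he hbe hb = shift-isometry L L-⊕ L-L q-shift
    where
    σ : Bool
    σ = bit (q b)

    m : El n → Bool
    m x = bilᵇ x b xor (bilᵇ x e ∧ σ)

    L : El n → El n
    L x = bilᵇ x e • b ⊕v m x • e

    m-⊕ : ∀ x y → m (x ⊕v y) ≡ m x xor m y
    m-⊕ x y rewrite bilᵇ-⊕ˡ x y b | bilᵇ-⊕ˡ x y e =
      decide (∀ᵇ? λ a → ∀ᵇ? λ a' → ∀ᵇ? λ c → ∀ᵇ? λ c' → ∀ᵇ? λ s →
                ((a xor a') xor ((c xor c') ∧ s)) Bool.≟ ((a xor (c ∧ s)) xor (a' xor (c' ∧ s))))
        (bilᵇ x b) (bilᵇ y b) (bilᵇ x e) (bilᵇ y e) σ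

    L-⊕ : ∀ x y → L (x ⊕v y) ≡ L x ⊕v L y
    L-⊕ x y = trans (cong₂ _⊕v_ (•-⊕ (λ x → bilᵇ x e) (λ x y → bilᵇ-⊕ˡ x y e) b x y) (•-⊕ m m-⊕ e x y))
                    (⊕-interchange _ _ _ _)

    bil-L : ∀ x w → bil q b w ≡ z0 → bil q e w ≡ z0 → bil q (L x) w ≡ z0
    bil-L x w hb' he' = begin
      bil q (bilᵇ x e • b ⊕v m x • e) w
        ≡⟨ linˡ _ _ w ⟩
      bil q (bilᵇ x e • b) w +₄ bil q (m x • e) w
        ≡⟨ cong₂ _+₄_ (bil-•ˡ (bilᵇ x e) b w) (bil-•ˡ (m x) e w) ⟩
      bilᵇ x e •₄ bil q b w +₄ m x •₄ bil q e w
        ≡⟨ cong₂ (λ s t → bilᵇ x e •₄ s +₄ m x •₄ t) hb' he' ⟩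
      bilᵇ x e •₄ z0 +₄ m x •₄ z0
        ≡⟨ cong₂ _+₄_ (Bool.if-eta (bilᵇ x e)) (Bool.if-eta (m x)) ⟩
      z0 ∎

    bil-bb : bil q b b ≡ z0
    bil-bb = trans (bil-self b) (2·₄-even-zero (q b) hb)

    L-L : ∀ x → L (L x) ≡ 0v
    L-L x rewrite bil-L x e hbe (trans (bil-self e) (cong (2 ·₄_) he))
                | bil-L x b bil-bb (trans (symm e b) hbe) = ⊕-identityˡ 0v

    q-L : ∀ x → q (L x) ≡ (bilᵇ x e •₄ (σ •₄ z2) +₄ m x •₄ z0) +₄ z0
    q-L x = begin
      q (c • b ⊕v m x • e)                                      ≡⟨ q-⊕ (c • b) (m x • e) ⟩
      (q (c • b) +₄ q (m x • e)) +₄ bil q (c • b) (m x • e)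
        ≡⟨ cong₃ (λ s t u → (s +₄ t) +₄ u) (q-• c b) (q-• (m x) e) bil-cb-me ⟩
      (c •₄ q b +₄ m x •₄ q e) +₄ z0
        ≡⟨ cong₂ (λ s t → (c •₄ s +₄ m x •₄ t) +₄ z0) (even-bit (q b) hb) he ⟩
      (c •₄ (σ •₄ z2) +₄ m x •₄ z0) +₄ z0                       ∎
      where
      c : Bool
      c = bilᵇ x e
      bil-cb-me : bil q (c • b) (m x • e) ≡ z0
      bil-cb-me = trans (bil-•ˡ c b (m x • e))
        (trans (cong (c •₄_) (trans (bil-•ʳ (m x) b e) (trans (cong (m x •₄_) hbe) (Bool.if-eta (m x)))))
               (Bool.if-eta c))

    bil-x-L : ∀ x → bil q x (L x) ≡ bilᵇ x e •₄ (bilᵇ x b •₄ z2) +₄ m x •₄ (bilᵇ x e •₄ z2)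
    bil-x-L x = trans (linʳ x _ _)
      (cong₂ _+₄_ (trans (bil-•ʳ (bilᵇ x e) x b) (cong (bilᵇ x e •₄_) (bil-bilᵇ x b)))
                  (trans (bil-•ʳ (m x) x e) (cong (m x •₄_) (bil-bilᵇ x e))))

    q-shift : ∀ x → q (x ⊕v L x) ≡ q x
    q-shift x = begin
      q (x ⊕v L x)
        ≡⟨ q-⊕ x (L x) ⟩
      (q x +₄ q (L x)) +₄ bil q x (L x)
        ≡⟨ cong₂ (λ s t → (q x +₄ s) +₄ t) (q-L x) (bil-x-L x) ⟩
      (q x +₄ ((c •₄ (σ •₄ z2) +₄ m x •₄ z0) +₄ z0)) +₄ (c •₄ (bilᵇ x b •₄ z2) +₄ m x •₄ (c •₄ z2))
        ≡⟨ decide (∀₄? λ a → ∀ᵇ? λ c → ∀ᵇ? λ s → ∀ᵇ? λ β →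
             (a +₄ ((c •₄ (s •₄ z2) +₄ (β xor (c ∧ s)) •₄ z0) +₄ z0))
               +₄ (c •₄ (β •₄ z2) +₄ (β xor (c ∧ s)) •₄ (c •₄ z2)) ≟₄ a)
             (q x) c σ (bilᵇ x b) ⟩
      q x ∎
      where
      c : Bool
      c = bilᵇ x e

-- Symbolic computation in the span of k vectors with known Gram data

-- A vector c ∈ (ℤ/2)^k stands for Σᵢ cᵢ gᵢ, where q(gᵢ) = Q i and (gᵢ, gⱼ) = B i j.
row : ∀ {k} → (Fin k → Z4) → El k → Z4
row r [] = z0
row r (d ∷ ds) = d •₄ r zero +₄ row (λ j → r (suc j)) ds

bilsym : ∀ {k l} → (Fin k → Fin l → Z4) → El k → El l → Z4
bilsym B [] d = z0
bilsym B (c ∷ cs) d = c •₄ row (B zero) d +₄ bilsym (λ i → B (suc i)) cs d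

qsym : ∀ {k} → (Fin k → Z4) → (Fin k → Fin k → Z4) → El k → Z4
qsym Q B [] = z0
qsym Q B (c ∷ cs) =
  (c •₄ Q zero +₄ qsym (λ i → Q (suc i)) (λ i j → B (suc i) (suc j)) cs) +₄ c •₄ row (λ j → B zero (suc j)) cs

-- Symbolic counterparts of transvection and eichler; see apply.
data Move (k : ℕ) : Set where
  τ[_] : El k → Move k
  E[_,_] : El k → El k → Move k

module _ {k : ℕ} (Q : Fin k → Z4) (B : Fin k → Fin k → Z4) where

  Valid : Move k → Set
  Valid (τ[ v ]) = qsym Q B v ≡ z2
  Valid (E[ e , b ]) = qsym Q B e ≡ z0 × bilsym B b e ≡ z0 × Even (qsym Q B b)

  valid? : ∀ m → Dec (Valid m)
  valid? (τ[ v ]) = qsym Q B v ≟₄ z2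
  valid? (E[ e , b ]) = (qsym Q B e ≟₄ z0) ×-dec (bilsym B b e ≟₄ z0) ×-dec even? (qsym Q B b)

  bitsym : El k → El k → Bool
  bitsym c v = bit (bilsym B c v)

  apply : Move k → El k → El k
  apply (τ[ v ]) c = c ⊕v bitsym c v • v
  apply (E[ e , b ]) c = c ⊕v (bitsym c e • b ⊕v (bitsym c b xor (bitsym c e ∧ bit (qsym Q B b))) • e)

  Run : List (Move k) → El k → El k → Set
  Run [] c y = c ≡ y
  Run (m ∷ ms) c y = Valid m × Run ms (apply m c) y

  run? : ∀ ms c y → Dec (Run ms c y)
  run? [] c y = c ≟v y
  run? (m ∷ ms) c y = valid? m ×-dec run? ms (apply m c) y

module Symbolic {n : ℕ} {q : QuadFn n} (F : IsFQF q) where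
  open FQF F
  open ElementaryIsometries F
  open ≡-Reasoning

  eval : ∀ {k} → (Fin k → El n) → El k → El n
  eval g [] = 0v
  eval g (c ∷ cs) = c • g zero ⊕v eval (λ i → g (suc i)) cs

  eval-⊕ : ∀ {k} (g : Fin k → El n) c d → eval g (c ⊕v d) ≡ eval g c ⊕v eval g d
  eval-⊕ g [] [] = sym (⊕-identityˡ 0v)
  eval-⊕ g (c ∷ cs) (d ∷ ds) =
    trans (cong₂ _⊕v_ (•-distrib-xor c d (g zero)) (eval-⊕ (λ i → g (suc i)) cs ds)) (⊕-interchange _ _ _ _)

  eval-0v : ∀ {k} (g : Fin k → El n) → eval g 0v ≡ 0v
  eval-0v {zero} g = refl
  eval-0v {suc k} g = trans (⊕-identityˡ _) (eval-0v (λ i → g (suc i)))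

  eval-• : ∀ {k} (g : Fin k → El n) b c → eval g (b • c) ≡ b • eval g c
  eval-• g true c = refl
  eval-• g false c = eval-0v g

  bil-row : ∀ {k} (g : Fin k → El n) x (r : Fin k → Z4) → (∀ j → bil q x (g j) ≡ r j) →
            ∀ d → bil q x (eval g d) ≡ row r d
  bil-row g x r hr [] = bil-0ʳ x
  bil-row g x r hr (d ∷ ds) = trans (linʳ x _ _)
    (cong₂ _+₄_ (trans (bil-•ʳ d x (g zero)) (cong (d •₄_) (hr zero)))
                (bil-row (λ j → g (suc j)) x (λ j → r (suc j)) (λ j → hr (suc j)) ds))

  bil-eval : ∀ {k l} (g : Fin k → El n) (h : Fin l → El n) B → (∀ i j → bil q (g i) (h j) ≡ B i j) →
             ∀ c d → bil q (eval g c) (eval h d) ≡ bilsym B c d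
  bil-eval g h B hB [] d = bil-0ˡ _
  bil-eval g h B hB (c ∷ cs) d = trans (linˡ _ _ _)
    (cong₂ _+₄_ (trans (bil-•ˡ c (g zero) _) (cong (c •₄_) (bil-row h (g zero) (B zero) (hB zero) d)))
                (bil-eval (λ i → g (suc i)) h (λ i → B (suc i)) (λ i → hB (suc i)) cs d))

  q-eval : ∀ {k} (g : Fin k → El n) Q B → (∀ i → q (g i) ≡ Q i) → (∀ i j → bil q (g i) (g j) ≡ B i j) →
           ∀ c → q (eval g c) ≡ qsym Q B c
  q-eval g Q B hQ hB [] = q-0v
  q-eval {suc k} g Q B hQ hB (c ∷ cs) = begin
    q (c • g zero ⊕v eval g' cs)
      ≡⟨ q-⊕ _ _ ⟩
    (q (c • g zero) +₄ q (eval g' cs)) +₄ bil q (c • g zero) (eval g' cs)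
      ≡⟨ cong₂ (λ s t → (s +₄ q (eval g' cs)) +₄ t) (q-• c (g zero)) (bil-•ˡ c (g zero) _) ⟩
    (c •₄ q (g zero) +₄ q (eval g' cs)) +₄ c •₄ bil q (g zero) (eval g' cs)
      ≡⟨ cong₃ (λ s t u → (c •₄ s +₄ t) +₄ c •₄ u) (hQ zero)
           (q-eval g' _ _ (λ i → hQ (suc i)) (λ i j → hB (suc i) (suc j)) cs)
           (bil-row g' (g zero) _ (λ j → hB zero (suc j)) cs) ⟩
    qsym Q B (c ∷ cs) ∎
    where
    g' : Fin k → El n
    g' i = g (suc i)

  module _ {k : ℕ} (g : Fin k → El n) (Q : Fin k → Z4) (B : Fin k → Fin k → Z4)
           (hQ : ∀ i → q (g i) ≡ Q i) (hB : ∀ i j → bil q (g i) (g j) ≡ B i j) where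

    bilᵇ-eval : ∀ c d → bilᵇ (eval g c) (eval g d) ≡ bitsym Q B c d
    bilᵇ-eval c d = cong bit (bil-eval g g B hB c d)

    move-orbit : ∀ m c → Valid Q B m → Orbit q (eval g c) (eval g (apply Q B m c))
    move-orbit (τ[ v ]) c hv = transvection (eval g v) (trans (q-eval g Q B hQ hB v) hv) , sym (begin
      eval g (c ⊕v bitsym Q B c v • v)        ≡⟨ eval-⊕ g c _ ⟩
      eval g c ⊕v eval g (bitsym Q B c v • v) ≡⟨ cong (eval g c ⊕v_) (eval-• g (bitsym Q B c v) v) ⟩
      eval g c ⊕v bitsym Q B c v • eval g v   ≡⟨ cong (λ t → eval g c ⊕v t • eval g v) (bilᵇ-eval c v) ⟨
      eval g c ⊕v bilᵇ (eval g c) (eval g v) • eval g v ∎)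
    move-orbit (E[ e , b ]) c (he , hbe , hb) = E , sym (begin
      eval g (c ⊕v (s • b ⊕v t • e))
        ≡⟨ eval-⊕ g c _ ⟩
      eval g c ⊕v eval g (s • b ⊕v t • e)
        ≡⟨ cong (eval g c ⊕v_) (eval-⊕ g (s • b) (t • e)) ⟩
      eval g c ⊕v (eval g (s • b) ⊕v eval g (t • e))
        ≡⟨ cong₂ (λ u w → eval g c ⊕v (u ⊕v w)) (eval-• g s b) (eval-• g t e) ⟩
      eval g c ⊕v (s • eval g b ⊕v t • eval g e)
        ≡⟨ cong₃ (λ s' β σ → eval g c ⊕v (s' • eval g b ⊕v (β xor (s' ∧ σ)) • eval g e))
             (bilᵇ-eval c e) (bilᵇ-eval c b) (cong bit (q-eval g Q B hQ hB b)) ⟨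
      fun E (eval g c) ∎)
      where
      E : Isometry q q
      E = eichler (eval g e) (eval g b) (trans (q-eval g Q B hQ hB e) he) (trans (bil-eval g g B hB b e) hbe)
                  (subst Even (sym (q-eval g Q B hQ hB b)) hb)
      s t : Bool
      s = bitsym Q B c e
      t = bitsym Q B c b xor (s ∧ bit (qsym Q B b))

    run-orbit : ∀ ms c y → Run Q B ms c y → Orbit q (eval g c) (eval g y)
    run-orbit [] c y refl = orbit-refl
    run-orbit (m ∷ ms) c y (hm , hms) = orbit-trans (move-orbit m c hm) (run-orbit ms (apply Q B m c) y hms)

-- Transitivity of O(A) on generic vectors of equal norm

pattern 𝟘 = zero
pattern 𝟙 = suc zero
pattern 𝟚 = suc (suc zero)
pattern 𝟛 = suc (suc (suc zero))

-- Gram data of u₁, u₂, ξ, ξ' for a hyperbolic pair u₁, u₂ and ξ, ξ' ⊥ u₁, u₂.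
wittQ : Z4 → Z4 → Fin 4 → Z4
wittQ qξ qξ' 𝟚 = qξ
wittQ qξ qξ' 𝟛 = qξ'
wittQ qξ qξ' _ = z0

wittB : Z4 → Z4 → Z4 → Fin 4 → Fin 4 → Z4
wittB qξ qξ' p 𝟘 𝟙 = z2
wittB qξ qξ' p 𝟙 𝟘 = z2
wittB qξ qξ' p 𝟚 𝟚 = 2 ·₄ qξ
wittB qξ qξ' p 𝟛 𝟛 = 2 ·₄ qξ'
wittB qξ qξ' p 𝟚 𝟛 = p
wittB qξ qξ' p 𝟛 𝟚 = p
wittB qξ qξ' p _ _ = z0

wittMoves : List (List (Move 4))
wittMoves =
  (E[ false ∷ true ∷ false ∷ false ∷ [] , false ∷ false ∷ true ∷ true ∷ [] ] ∷ []) ∷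
  (E[ true ∷ false ∷ false ∷ false ∷ [] , false ∷ false ∷ true ∷ true ∷ [] ] ∷ []) ∷
  (τ[ true ∷ true ∷ true ∷ true ∷ [] ] ∷ []) ∷
  (τ[ false ∷ true ∷ true ∷ true ∷ [] ] ∷ []) ∷
  (τ[ true ∷ false ∷ true ∷ true ∷ [] ] ∷ []) ∷
  (τ[ false ∷ false ∷ true ∷ true ∷ [] ] ∷ []) ∷
  (τ[ false ∷ false ∷ true ∷ true ∷ [] ] ∷ τ[ true ∷ true ∷ false ∷ false ∷ [] ] ∷ []) ∷ []

-- a₁ u₁ + a₂ u₂ + ξ and b₁ u₁ + b₂ u₂ + ξ' of equal norm, (a₁, a₂) ≠ 0 ≠ (b₁, b₂), are joined by one of
-- wittMoves. Opaque, so that the proof found by evaluation is never unfolded again.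
opaque
  witt-certificate : ∀ qξ qξ' p a₁ a₂ b₁ b₂ → Even p → T (a₁ ∨ a₂) → T (b₁ ∨ b₂) →
    let Q = wittQ qξ qξ' ; B = wittB qξ qξ' p
        x = a₁ ∷ a₂ ∷ true ∷ false ∷ [] ; y = b₁ ∷ b₂ ∷ false ∷ true ∷ []
    in qsym Q B x ≡ qsym Q B y → Any (λ ms → Run Q B ms x y) wittMoves
  witt-certificate = decide (∀₄? λ qξ → ∀₄? λ qξ' → ∀₄? λ p →
    ∀ᵇ? λ a₁ → ∀ᵇ? λ a₂ → ∀ᵇ? λ b₁ → ∀ᵇ? λ b₂ →
    even? p →-dec T? _ →-dec T? _ →-dec (_ ≟₄ _) →-dec
    any? (λ ms → run? (wittQ qξ qξ') (wittB qξ qξ' p) ms _ _) wittMoves)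

module Witt {n : ℕ} {q : QuadFn n} (F : IsFQF q) (u₁ u₂ : El n)
            (q-u₁ : q u₁ ≡ z0) (q-u₂ : q u₂ ≡ z0) (bil-u₁u₂ : bil q u₁ u₂ ≡ z2) where
  open FQF F
  open ElementaryIsometries F
  open Symbolic F
  open ≡-Reasoning

  bil-u₂u₁ : bil q u₂ u₁ ≡ z2
  bil-u₂u₁ = trans (symm u₂ u₁) bil-u₁u₂

  bil-u₁u₁ : bil q u₁ u₁ ≡ z0
  bil-u₁u₁ = trans (bil-self u₁) (cong (2 ·₄_) q-u₁)

  bil-u₂u₂ : bil q u₂ u₂ ≡ z0
  bil-u₂u₂ = trans (bil-self u₂) (cong (2 ·₄_) q-u₂)

  -- x = a₁ x u₁ + a₂ x u₂ + ξ x with ξ x ⊥ u₁, u₂.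
  a₁ a₂ : El n → Bool
  a₁ x = bilᵇ x u₂
  a₂ x = bilᵇ x u₁

  w : El n → El n
  w x = a₁ x • u₁ ⊕v a₂ x • u₂

  ξ : El n → El n
  ξ x = x ⊕v w x

  w⊕ξ : ∀ x → w x ⊕v ξ x ≡ x
  w⊕ξ x = trans (⊕-comm (w x) (ξ x)) (⊕-cancelʳ x (w x))

  bil-w : ∀ x y → bil q (w x) y ≡ a₁ x •₄ bil q u₁ y +₄ a₂ x •₄ bil q u₂ y
  bil-w x y = trans (linˡ _ _ y) (cong₂ _+₄_ (bil-•ˡ (a₁ x) u₁ y) (bil-•ˡ (a₂ x) u₂ y))

  bil-w-u₁ : ∀ x → bil q (w x) u₁ ≡ bil q x u₁
  bil-w-u₁ x = begin
    bil q (w x) u₁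
      ≡⟨ bil-w x u₁ ⟩
    a₁ x •₄ bil q u₁ u₁ +₄ a₂ x •₄ bil q u₂ u₁
      ≡⟨ cong₂ (λ s t → a₁ x •₄ s +₄ a₂ x •₄ t) bil-u₁u₁ bil-u₂u₁ ⟩
    a₁ x •₄ z0 +₄ a₂ x •₄ z2
      ≡⟨ cong (_+₄ a₂ x •₄ z2) (Bool.if-eta (a₁ x)) ⟩
    a₂ x •₄ z2
      ≡⟨ bil-bilᵇ x u₁ ⟨
    bil q x u₁ ∎

  bil-w-u₂ : ∀ x → bil q (w x) u₂ ≡ bil q x u₂
  bil-w-u₂ x = begin
    bil q (w x) u₂
      ≡⟨ bil-w x u₂ ⟩
    a₁ x •₄ bil q u₁ u₂ +₄ a₂ x •₄ bil q u₂ u₂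
      ≡⟨ cong₂ (λ s t → a₁ x •₄ s +₄ a₂ x •₄ t) bil-u₁u₂ bil-u₂u₂ ⟩
    a₁ x •₄ z2 +₄ a₂ x •₄ z0
      ≡⟨ cong (a₁ x •₄ z2 +₄_) (Bool.if-eta (a₂ x)) ⟩
    a₁ x •₄ z2 +₄ z0
      ≡⟨ +₄-identityʳ _ ⟩
    a₁ x •₄ z2
      ≡⟨ bil-bilᵇ x u₂ ⟨
    bil q x u₂ ∎

  ξ-⊥ : ∀ x u → bil q (w x) u ≡ bil q x u → bil q (ξ x) u ≡ z0
  ξ-⊥ x u h = trans (linˡ x (w x) u) (trans (cong (bil q x u +₄_) h)
                (decide (∀₄? λ a → even? a →-dec (a +₄ a ≟₄ z0)) _ (bil-even x u)))

  ξ-⊥u₁ : ∀ x → bil q (ξ x) u₁ ≡ z0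
  ξ-⊥u₁ x = ξ-⊥ x u₁ (bil-w-u₁ x)

  ξ-⊥u₂ : ∀ x → bil q (ξ x) u₂ ≡ z0
  ξ-⊥u₂ x = ξ-⊥ x u₂ (bil-w-u₂ x)

  bil-w-⊥ : ∀ x y → bil q y u₁ ≡ z0 → bil q y u₂ ≡ z0 → bil q (w x) y ≡ z0
  bil-w-⊥ x y y⊥u₁ y⊥u₂ = begin
    bil q (w x) y                                   ≡⟨ bil-w x y ⟩
    a₁ x •₄ bil q u₁ y +₄ a₂ x •₄ bil q u₂ y
      ≡⟨ cong₂ (λ s t → a₁ x •₄ s +₄ a₂ x •₄ t) (trans (symm u₁ y) y⊥u₁) (trans (symm u₂ y) y⊥u₂) ⟩
    a₁ x •₄ z0 +₄ a₂ x •₄ z0                        ≡⟨ cong₂ _+₄_ (Bool.if-eta (a₁ x)) (Bool.if-eta (a₂ x)) ⟩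
    z0                                              ∎

  bil-ξ : ∀ x y → bil q y u₁ ≡ z0 → bil q y u₂ ≡ z0 → bil q (ξ x) y ≡ bil q x y
  bil-ξ x y y⊥u₁ y⊥u₂ =
    trans (linˡ x (w x) y) (trans (cong (bil q x y +₄_) (bil-w-⊥ x y y⊥u₁ y⊥u₂)) (+₄-identityʳ _))

  q-w-even : ∀ x → Even (q (w x))
  q-w-even x = subst Even (sym (begin
    q (a₁ x • u₁ ⊕v a₂ x • u₂)
      ≡⟨ q-⊕ _ _ ⟩
    (q (a₁ x • u₁) +₄ q (a₂ x • u₂)) +₄ bil q (a₁ x • u₁) (a₂ x • u₂)
      ≡⟨ cong₃ (λ s t u → (s +₄ t) +₄ u) (q-• (a₁ x) u₁) (q-• (a₂ x) u₂)
               (trans (bil-•ˡ (a₁ x) u₁ _) (cong (a₁ x •₄_) (bil-•ʳ (a₂ x) u₁ u₂))) ⟩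
    (a₁ x •₄ q u₁ +₄ a₂ x •₄ q u₂) +₄ a₁ x •₄ (a₂ x •₄ bil q u₁ u₂)
      ≡⟨ cong₃ (λ s t u → (a₁ x •₄ s +₄ a₂ x •₄ t) +₄ a₁ x •₄ (a₂ x •₄ u)) q-u₁ q-u₂ bil-u₁u₂ ⟩
    (a₁ x •₄ z0 +₄ a₂ x •₄ z0) +₄ a₁ x •₄ (a₂ x •₄ z2) ∎))
    (decide (∀ᵇ? λ b → ∀ᵇ? λ b' → even? ((b •₄ z0 +₄ b' •₄ z0) +₄ b •₄ (b' •₄ z2))) (a₁ x) (a₂ x))

  2q-ξ : ∀ x → 2 ·₄ q (ξ x) ≡ 2 ·₄ q x
  2q-ξ x = begin
    2 ·₄ q (ξ x)
      ≡⟨ decide (∀₄? λ e → ∀₄? λ t → even? e →-dec (2 ·₄ t ≟₄ 2 ·₄ ((e +₄ t) +₄ z0))) _ _ (q-w-even x) ⟩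
    2 ·₄ ((q (w x) +₄ q (ξ x)) +₄ z0)
      ≡⟨ cong (λ t → 2 ·₄ ((q (w x) +₄ q (ξ x)) +₄ t)) (bil-w-⊥ x (ξ x) (ξ-⊥u₁ x) (ξ-⊥u₂ x)) ⟨
    2 ·₄ ((q (w x) +₄ q (ξ x)) +₄ bil q (w x) (ξ x))  ≡⟨ cong (2 ·₄_) (q-⊕ (w x) (ξ x)) ⟨
    2 ·₄ q (w x ⊕v ξ x)                               ≡⟨ cong (λ t → 2 ·₄ q t) (w⊕ξ x) ⟩
    2 ·₄ q x                                          ∎

  even-partner : ∀ x α β → bil q α u₁ ≡ z0 → bil q β u₁ ≡ z0 → ¬ bil q x α ≡ 2 ·₄ q α → bil q x β ≡ z2 →
                 ∃ λ γ → bil q x γ ≡ z2 × bil q γ u₁ ≡ z0 × Even (q γ)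
  even-partner x α β α⊥u₁ β⊥u₁ hα hβ with even? (q α) | even? (q β)
  ... | yes α-even | _ = α , bil-xα , α⊥u₁ , α-even
    where
    bil-xα : bil q x α ≡ z2
    bil-xα = decide (∀₄? λ t → ∀₄? λ e → even? t →-dec even? e →-dec ¬? (e ≟₄ 2 ·₄ t) →-dec (e ≟₄ z2))
               _ _ α-even (bil-even x α) hα
  ... | no α-odd | yes β-even = β , hβ , β⊥u₁ , β-even
  ... | no α-odd | no β-odd = α ⊕v β , bil-xαβ , trans (linˡ α β u₁) (cong₂ _+₄_ α⊥u₁ β⊥u₁) , q-αβ-even
    where
    bil-xα : bil q x α ≡ z0
    bil-xα = decide (∀₄? λ t → ∀₄? λ e → odd? t →-dec even? e →-dec ¬? (e ≟₄ 2 ·₄ t) →-dec (e ≟₄ z0))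
               _ _ α-odd (bil-even x α) hα
    bil-xαβ : bil q x (α ⊕v β) ≡ z2
    bil-xαβ = trans (linʳ x α β) (cong₂ _+₄_ bil-xα hβ)
    q-αβ-even : Even (q (α ⊕v β))
    q-αβ-even = subst Even (sym (q-⊕ α β))
      (decide (∀₄? λ s → ∀₄? λ t → ∀₄? λ u → odd? s →-dec odd? t →-dec even? u →-dec even? ((s +₄ t) +₄ u))
        _ _ _ α-odd β-odd (bil-even α β))

  partner : ∀ x → bil q x u₁ ≡ z0 → bil q x u₂ ≡ z0 → Generic q x →
            ∃ λ γ → bil q x γ ≡ z2 × bil q γ u₁ ≡ z0 × Even (q γ)
  partner x x⊥u₁ x⊥u₂ (x≢0 , x-nonchar) =
    even-partner x (ξ a) (ξ b) (ξ-⊥u₁ a) (ξ-⊥u₁ b) bil-xα≢2qα bil-xβ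
    where
    a b : El n
    a = proj₁ (noncharacteristic-witness x x-nonchar)
    b = proj₁ (nondeg-witness x x≢0)
    bil-xα≢2qα : ¬ bil q x (ξ a) ≡ 2 ·₄ q (ξ a)
    bil-xα≢2qα h = proj₂ (noncharacteristic-witness x x-nonchar) (begin
      bil q a x         ≡⟨ bil-ξ a x x⊥u₁ x⊥u₂ ⟨
      bil q (ξ a) x     ≡⟨ symm (ξ a) x ⟩
      bil q x (ξ a)     ≡⟨ h ⟩
      2 ·₄ q (ξ a)      ≡⟨ 2q-ξ a ⟩
      2 ·₄ q a          ∎)
    bil-xβ : bil q x (ξ b) ≡ z2
    bil-xβ = trans (symm x (ξ b)) (trans (bil-ξ b x x⊥u₁ x⊥u₂) (trans (symm b x) (proj₂ (nondeg-witness x x≢0))))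

  normalise-⊥ : ∀ x → bil q x u₁ ≡ z0 → bil q x u₂ ≡ z0 → Generic q x → ∃ λ x' → Orbit q x x' × a₁ x' ≡ true
  normalise-⊥ x x⊥u₁ x⊥u₂ gx with partner x x⊥u₁ x⊥u₂ gx
  ... | γ , bil-xγ , γ⊥u₁ , γ-even = fun E x , (E , refl) , a₁-Ex
    where
    E : Isometry q q
    E = eichler u₁ γ q-u₁ γ⊥u₁ γ-even
    Ex : fun E x ≡ x ⊕v u₁
    Ex = trans (cong₂ (λ s t → x ⊕v (bit s • γ ⊕v (bit t xor (bit s ∧ bit (q γ))) • u₁)) x⊥u₁ bil-xγ)
               (cong (x ⊕v_) (⊕-identityˡ u₁))
    a₁-Ex : a₁ (fun E x) ≡ true
    a₁-Ex = cong bit (trans (cong (λ t → bil q t u₂) Ex) (trans (linˡ x u₁ u₂) (cong₂ _+₄_ x⊥u₂ bil-u₁u₂)))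

  normalise : ∀ x → Generic q x → ∃ λ x' → Orbit q x x' × T (a₁ x' ∨ a₂ x')
  normalise x gx with a₁ x in h₁ | a₂ x in h₂
  ... | true | _ = x , orbit-refl , subst (λ b → T (b ∨ a₂ x)) (sym h₁) _
  ... | false | true = x , orbit-refl , subst (λ b → T (a₁ x ∨ b)) (sym h₂) (subst (λ b → T (b ∨ true)) (sym h₁) _)
  ... | false | false =
    let (x' , x~x' , a₁x') = normalise-⊥ x (trans (bil-bilᵇ x u₁) (cong (_•₄ z2) h₂))
                                            (trans (bil-bilᵇ x u₂) (cong (_•₄ z2) h₁)) gx
    in x' , x~x' , subst (λ b → T (b ∨ a₂ x')) (sym a₁x') _

  module _ (x y : El n) where
    gens : Fin 4 → El n
    gens 𝟘 = u₁
    gens 𝟙 = u₂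
    gens 𝟚 = ξ x
    gens 𝟛 = ξ y

    Q : Fin 4 → Z4
    Q = wittQ (q (ξ x)) (q (ξ y))

    B : Fin 4 → Fin 4 → Z4
    B = wittB (q (ξ x)) (q (ξ y)) (bil q (ξ x) (ξ y))

    q-gens : ∀ i → q (gens i) ≡ Q i
    q-gens 𝟘 = q-u₁
    q-gens 𝟙 = q-u₂
    q-gens 𝟚 = refl
    q-gens 𝟛 = refl

    bil-gens : ∀ i j → bil q (gens i) (gens j) ≡ B i j
    bil-gens 𝟘 𝟘 = bil-u₁u₁
    bil-gens 𝟘 𝟙 = bil-u₁u₂
    bil-gens 𝟘 𝟚 = trans (symm u₁ (ξ x)) (ξ-⊥u₁ x)
    bil-gens 𝟘 𝟛 = trans (symm u₁ (ξ y)) (ξ-⊥u₁ y)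
    bil-gens 𝟙 𝟘 = bil-u₂u₁
    bil-gens 𝟙 𝟙 = bil-u₂u₂
    bil-gens 𝟙 𝟚 = trans (symm u₂ (ξ x)) (ξ-⊥u₂ x)
    bil-gens 𝟙 𝟛 = trans (symm u₂ (ξ y)) (ξ-⊥u₂ y)
    bil-gens 𝟚 𝟘 = ξ-⊥u₁ x
    bil-gens 𝟚 𝟙 = ξ-⊥u₂ x
    bil-gens 𝟚 𝟚 = bil-self (ξ x)
    bil-gens 𝟚 𝟛 = refl
    bil-gens 𝟛 𝟘 = ξ-⊥u₁ y
    bil-gens 𝟛 𝟙 = ξ-⊥u₂ y
    bil-gens 𝟛 𝟚 = symm (ξ y) (ξ x)
    bil-gens 𝟛 𝟛 = bil-self (ξ y)

    eval-x : eval gens (a₁ x ∷ a₂ x ∷ true ∷ false ∷ []) ≡ x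
    eval-x = begin
      a₁ x • u₁ ⊕v (a₂ x • u₂ ⊕v (ξ x ⊕v (0v ⊕v 0v)))
        ≡⟨ cong (λ t → a₁ x • u₁ ⊕v (a₂ x • u₂ ⊕v t))
                (trans (cong (ξ x ⊕v_) (⊕-self 0v)) (⊕-identityʳ (ξ x))) ⟩
      a₁ x • u₁ ⊕v (a₂ x • u₂ ⊕v ξ x)
        ≡⟨ ⊕-assoc _ _ _ ⟨
      w x ⊕v ξ x
        ≡⟨ w⊕ξ x ⟩
      x ∎

    eval-y : eval gens (a₁ y ∷ a₂ y ∷ false ∷ true ∷ []) ≡ y
    eval-y = begin
      a₁ y • u₁ ⊕v (a₂ y • u₂ ⊕v (0v ⊕v (ξ y ⊕v 0v)))
        ≡⟨ cong (λ t → a₁ y • u₁ ⊕v (a₂ y • u₂ ⊕v t)) (trans (⊕-identityˡ _) (⊕-identityʳ (ξ y))) ⟩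
      a₁ y • u₁ ⊕v (a₂ y • u₂ ⊕v ξ y)                 ≡⟨ ⊕-assoc _ _ _ ⟨
      w y ⊕v ξ y                                      ≡⟨ w⊕ξ y ⟩
      y                                               ∎

    qsym-eq : q x ≡ q y → qsym Q B (a₁ x ∷ a₂ x ∷ true ∷ false ∷ []) ≡ qsym Q B (a₁ y ∷ a₂ y ∷ false ∷ true ∷ [])
    qsym-eq qx≡qy = begin
        qsym Q B (a₁ x ∷ a₂ x ∷ true ∷ false ∷ [])
          ≡⟨ q-eval gens Q B q-gens bil-gens (a₁ x ∷ a₂ x ∷ true ∷ false ∷ []) ⟨
        q (eval gens (a₁ x ∷ a₂ x ∷ true ∷ false ∷ []))
          ≡⟨ cong q eval-x ⟩
        q x
          ≡⟨ qx≡qy ⟩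
        q y
          ≡⟨ cong q eval-y ⟨
        q (eval gens (a₁ y ∷ a₂ y ∷ false ∷ true ∷ []))
          ≡⟨ q-eval gens Q B q-gens bil-gens (a₁ y ∷ a₂ y ∷ false ∷ true ∷ []) ⟩
        qsym Q B (a₁ y ∷ a₂ y ∷ false ∷ true ∷ []) ∎

    witt-normal : T (a₁ x ∨ a₂ x) → T (a₁ y ∨ a₂ y) → q x ≡ q y → Orbit q x y
    witt-normal tx ty qx≡qy = subst₂ (Orbit q) eval-x eval-y (run-orbit gens Q B q-gens bil-gens ms cx cy run)
      where
      cx cy : El 4
      cx = a₁ x ∷ a₂ x ∷ true ∷ false ∷ []
      cy = a₁ y ∷ a₂ y ∷ false ∷ true ∷ []
      cert : Any (λ ms → Run Q B ms cx cy) wittMoves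
      cert = witt-certificate (q (ξ x)) (q (ξ y)) (bil q (ξ x) (ξ y)) (a₁ x) (a₂ x) (a₁ y) (a₂ y)
               (bil-even (ξ x) (ξ y)) tx ty (qsym-eq qx≡qy)
      ms : List (Move 4)
      ms = proj₁ (satisfied cert)
      run : Run Q B ms cx cy
      run = proj₂ (satisfied cert)


  witt : ∀ {x y} → Generic q x → Generic q y → q x ≡ q y → Orbit q x y
  witt {x} {y} gx gy qx≡qy =
    let (x' , x~x' , tx') = normalise x gx
        (y' , y~y' , ty') = normalise y gy
    in orbit-trans x~x' (orbit-trans
         (witt-normal x' y' tx' ty' (trans (sym (orbit-q x~x')) (trans qx≡qy (orbit-q y~y'))))
         (orbit-sym y~y'))

-i_ : ℤi → ℤi
-i (a , b) = (- a , - b)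

+i-abelianGroup : AbelianGroup 0ℓ 0ℓ
+i-abelianGroup = record
  { Carrier = ℤi ; _≈_ = _≡_ ; _∙_ = _+i_ ; ε = 0i ; _⁻¹ = -i_
  ; isAbelianGroup = record
    { isGroup = record
      { isMonoid = record
        { isSemigroup = record
          { isMagma = record { isEquivalence = isEquivalence ; ∙-cong = cong₂ _+i_ }
          ; assoc = λ (a , b) (c , d) (f , g) → cong₂ _,_ (ℤ.+-assoc a c f) (ℤ.+-assoc b d g) }
        ; identity = (λ (a , b) → cong₂ _,_ (ℤ.+-identityˡ a) (ℤ.+-identityˡ b))
                   , (λ (a , b) → cong₂ _,_ (ℤ.+-identityʳ a) (ℤ.+-identityʳ b)) }
      ; inverse = (λ (a , b) → cong₂ _,_ (ℤ.+-inverseˡ a) (ℤ.+-inverseˡ b))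
                , (λ (a , b) → cong₂ _,_ (ℤ.+-inverseʳ a) (ℤ.+-inverseʳ b))
      ; ⁻¹-cong = cong -i_ }
    ; comm = λ (a , b) (c , d) → cong₂ _,_ (ℤ.+-comm a c) (ℤ.+-comm b d) } }

open AbelianGroup +i-abelianGroup public
  using () renaming (assoc to +i-assoc; comm to +i-comm; identityˡ to +i-identityˡ; identityʳ to +i-identityʳ;
                     inverseʳ to +i-inverseʳ)
open import Algebra.Properties.AbelianGroup +i-abelianGroup public
  using () renaming (⁻¹-∙-comm to -i-+i-comm)
open import Algebra.Properties.CommutativeSemigroup (AbelianGroup.commutativeSemigroup +i-abelianGroup) public
  using () renaming (interchange to +i-interchange)

infix 4 _≟i_
_≟i_ : DecidableEquality ℤi
_≟i_ = ≡-dec ℤ._≟_ ℤ._≟_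

four : ℤi → ℤi
four x = (x +i x) +i (x +i x)

four-+i : ∀ x y → four (x +i y) ≡ four x +i four y
four-+i x y = trans (cong₂ _+i_ (+i-interchange x y x y) (+i-interchange x y x y))
                    (+i-interchange (x +i x) (y +i y) (x +i x) (y +i y))

four-zero : ∀ x → four x ≡ 0i → x ≡ 0i
four-zero (a , b) h = cong₂ _,_ (four-zeroℤ a (cong proj₁ h)) (four-zeroℤ b (cong proj₂ h))
  where
  four-zeroℤ : ∀ (a : ℤ) → (a ℤ.+ a) ℤ.+ (a ℤ.+ a) ≡ + 0 → a ≡ + 0
  four-zeroℤ (+ zero) _ = refl

four-injective : ∀ x y → four x ≡ four y → x ≡ y
four-injective x y h = x∙y⁻¹≈ε⇒x≈y x y (four-zero (x +i (-i y)) (begin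
  four (x +i (-i y))        ≡⟨ four-+i x (-i y) ⟩
  four x +i four (-i y)
    ≡⟨ cong₂ _+i_ h (trans (cong₂ _+i_ (-i-+i-comm y y) (-i-+i-comm y y)) (-i-+i-comm (y +i y) (y +i y))) ⟩
  four y +i (-i four y)     ≡⟨ +i-inverseʳ (four y) ⟩
  0i                        ∎))
  where
  open ≡-Reasoning
  open import Algebra.Properties.AbelianGroup +i-abelianGroup using (x∙y⁻¹≈ε⇒x≈y)

self-negating : ∀ x → x ≡ -i x → x ≡ 0i
self-negating x h = four-zero x (begin
  (x +i x) +i (x +i x)          ≡⟨ cong (λ t → (x +i x) +i (x +i t)) h ⟩
  (x +i x) +i (x +i (-i x))     ≡⟨ cong (λ t → (x +i x) +i (t +i (-i x))) h ⟩
  (x +i x) +i ((-i x) +i (-i x)) ≡⟨ cong ((x +i x) +i_) (-i-+i-comm x x) ⟩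
  (x +i x) +i (-i (x +i x))     ≡⟨ +i-inverseʳ (x +i x) ⟩
  0i                            ∎)
  where open ≡-Reasoning

private variable
  A B : Set

∑ : List A → (A → ℤi) → ℤi
∑ [] f = 0i
∑ (y ∷ ys) f = f y +i ∑ ys f


∑-cong : ∀ L {f g : A → ℤi} → (∀ x → f x ≡ g x) → ∑ L f ≡ ∑ L g
∑-cong [] h = refl
∑-cong (y ∷ ys) h = cong₂ _+i_ (h y) (∑-cong ys h)

∑-+i : ∀ L (f g : A → ℤi) → ∑ L (λ x → f x +i g x) ≡ ∑ L f +i ∑ L g
∑-+i [] f g = sym (+i-identityˡ 0i)
∑-+i (y ∷ ys) f g = trans (cong ((f y +i g y) +i_) (∑-+i ys f g)) (+i-interchange (f y) (g y) (∑ ys f) (∑ ys g))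

∑-zero : ∀ L {f : A → ℤi} → (∀ x → f x ≡ 0i) → ∑ L f ≡ 0i
∑-zero [] h = refl
∑-zero (y ∷ ys) h = trans (cong₂ _+i_ (h y) (∑-zero ys h)) (+i-identityˡ 0i)

∑--i : ∀ L (f : A → ℤi) → ∑ L (λ x → -i f x) ≡ -i ∑ L f
∑--i [] f = refl
∑--i (y ∷ ys) f = trans (cong ((-i f y) +i_) (∑--i ys f)) (-i-+i-comm (f y) (∑ ys f))

∑-four : ∀ L (f : A → ℤi) → ∑ L (λ x → four (f x)) ≡ four (∑ L f)
∑-four L f = trans (∑-+i L _ _) (cong₂ _+i_ (∑-+i L f f) (∑-+i L f f))

∑-++ : ∀ L M (f : A → ℤi) → ∑ (L ++ M) f ≡ ∑ L f +i ∑ M f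
∑-++ [] M f = sym (+i-identityˡ _)
∑-++ (y ∷ ys) M f = trans (cong (f y +i_) (∑-++ ys M f)) (sym (+i-assoc (f y) (∑ ys f) (∑ M f)))

∑-map : ∀ L (g : A → B) (f : B → ℤi) → ∑ (map g L) f ≡ ∑ L (λ x → f (g x))
∑-map [] g f = refl
∑-map (y ∷ ys) g f = cong (f (g y) +i_) (∑-map ys g f)

∑-comm : ∀ L (M : List B) (f : A → B → ℤi) → ∑ L (λ x → ∑ M (f x)) ≡ ∑ M (λ y → ∑ L (λ x → f x y))
∑-comm [] M f = sym (∑-zero M (λ _ → refl))
∑-comm (x ∷ xs) M f = trans (cong (∑ M (f x) +i_) (∑-comm xs M f)) (sym (∑-+i M (f x) _))

infix 21 [_]·_
[_]·_ : ∀ {P : Set} → Dec P → ℤi → ℤi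
[ yes _ ]· a = a
[ no _ ]· a = 0i

module _ {P : Set} where

  [yes]· : ∀ (d : Dec P) {a} → P → [ d ]· a ≡ a
  [yes]· (yes _) p = refl
  [yes]· (no ¬p) p = ⊥-elim (¬p p)

  [no]· : ∀ (d : Dec P) {a} → ¬ P → [ d ]· a ≡ 0i
  [no]· (yes p) ¬p = ⊥-elim (¬p p)
  [no]· (no _) ¬p = refl

  []·-cong : ∀ (d : Dec P) {a b} → a ≡ b → [ d ]· a ≡ [ d ]· b
  []·-cong d refl = refl

[]·-⇔ : ∀ {P Q : Set} (d : Dec P) (d' : Dec Q) {a} → (P → Q) → (Q → P) → [ d ]· a ≡ [ d' ]· a
[]·-⇔ (yes p) d' to from = sym ([yes]· d' (to p))
[]·-⇔ (no ¬p) d' to from = sym ([no]· d' (λ q → ¬p (from q)))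

∑-[]· : ∀ {P : Set} L (d : Dec P) (f : A → ℤi) → ∑ L (λ x → [ d ]· f x) ≡ [ d ]· ∑ L f
∑-[]· L (yes _) f = refl
∑-[]· L (no _) f = ∑-zero L (λ _ → refl)

[]·-∷ : ∀ {n} b b₀ (y y₀ : El n) a → [ (b ∷ y) ≟v (b₀ ∷ y₀) ]· a ≡ [ b Bool.≟ b₀ ]· [ y ≟v y₀ ]· a
[]·-∷ false true y y₀ a = [no]· ((false ∷ y) ≟v (true ∷ y₀)) {a} (λ ())
[]·-∷ true false y y₀ a = [no]· ((true ∷ y) ≟v (false ∷ y₀)) {a} (λ ())
[]·-∷ false false y y₀ a = []·-⇔ ((false ∷ y) ≟v (false ∷ y₀)) (y ≟v y₀) {a} Vec.∷-injectiveʳ (cong (false ∷_))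
[]·-∷ true true y y₀ a = []·-⇔ ((true ∷ y) ≟v (true ∷ y₀)) (y ≟v y₀) {a} Vec.∷-injectiveʳ (cong (true ∷_))

∑El : ∀ n → (El n → ℤi) → ℤi
∑El n = ∑ (allEl n)

module _ where
  open ≡-Reasoning

  ∑El-suc : ∀ n f → ∑El (suc n) f ≡ ∑El n (λ y → f (false ∷ y)) +i ∑El n (λ y → f (true ∷ y))
  ∑El-suc n f = trans (∑-++ (map (false ∷_) (allEl n)) _ f)
                      (cong₂ _+i_ (∑-map (allEl n) (false ∷_) f) (∑-map (allEl n) (true ∷_) f))

  ∑El-translate : ∀ n (t : El n) (f : El n → ℤi) → ∑El n (λ y → f (y ⊕v t)) ≡ ∑El n f
  ∑El-translate zero [] f = refl
  ∑El-translate (suc n) (false ∷ t) f = begin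
    ∑El (suc n) (λ y → f (y ⊕v (false ∷ t)))                                    ≡⟨ ∑El-suc n _ ⟩
    ∑El n (λ y → f (false ∷ (y ⊕v t))) +i ∑El n (λ y → f (true ∷ (y ⊕v t)))
      ≡⟨ cong₂ _+i_ (∑El-translate n t (λ y → f (false ∷ y))) (∑El-translate n t (λ y → f (true ∷ y))) ⟩
    ∑El n (λ y → f (false ∷ y)) +i ∑El n (λ y → f (true ∷ y))                   ≡⟨ ∑El-suc n f ⟨
    ∑El (suc n) f                                                               ∎
  ∑El-translate (suc n) (true ∷ t) f = begin
    ∑El (suc n) (λ y → f (y ⊕v (true ∷ t)))
      ≡⟨ ∑El-suc n _ ⟩
    ∑El n (λ y → f (true ∷ (y ⊕v t))) +i ∑El n (λ y → f (false ∷ (y ⊕v t)))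
      ≡⟨ cong₂ _+i_ (∑El-translate n t (λ y → f (true ∷ y))) (∑El-translate n t (λ y → f (false ∷ y))) ⟩
    ∑El n (λ y → f (true ∷ y)) +i ∑El n (λ y → f (false ∷ y))
      ≡⟨ +i-comm (∑El n (λ y → f (true ∷ y))) _ ⟩
    ∑El n (λ y → f (false ∷ y)) +i ∑El n (λ y → f (true ∷ y))
      ≡⟨ ∑El-suc n f ⟨
    ∑El (suc n) f ∎

  ∑El-point : ∀ n (y₀ : El n) (f : El n → ℤi) → ∑El n (λ y → [ y ≟v y₀ ]· f y) ≡ f y₀
  ∑El-point zero [] f = +i-identityʳ (f [])
  ∑El-point (suc n) (b₀ ∷ y₀) f = begin
    ∑El (suc n) (λ y → [ y ≟v (b₀ ∷ y₀) ]· f y)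
      ≡⟨ ∑El-suc n _ ⟩
    half false +i half true
      ≡⟨ cong₂ _+i_ (∑El-half false) (∑El-half true) ⟩
    [ false Bool.≟ b₀ ]· f (false ∷ y₀) +i [ true Bool.≟ b₀ ]· f (true ∷ y₀)
      ≡⟨ pick b₀ ⟩
    f (b₀ ∷ y₀) ∎
    where
    half : Bool → ℤi
    half b = ∑El n (λ y → [ (b ∷ y) ≟v (b₀ ∷ y₀) ]· f (b ∷ y))

    ∑El-half : ∀ b → half b ≡ [ b Bool.≟ b₀ ]· f (b ∷ y₀)
    ∑El-half b = begin
      half b
        ≡⟨ ∑-cong (allEl n) (λ y → []·-∷ b b₀ y y₀ (f (b ∷ y))) ⟩
      ∑El n (λ y → [ b Bool.≟ b₀ ]· [ y ≟v y₀ ]· f (b ∷ y))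
        ≡⟨ ∑-[]· (allEl n) (b Bool.≟ b₀) _ ⟩
      [ b Bool.≟ b₀ ]· ∑El n (λ y → [ y ≟v y₀ ]· f (b ∷ y))
        ≡⟨ []·-cong (b Bool.≟ b₀) (∑El-point n y₀ (λ y → f (b ∷ y))) ⟩
      [ b Bool.≟ b₀ ]· f (b ∷ y₀) ∎

    pick : ∀ b → [ false Bool.≟ b ]· f (false ∷ y₀) +i [ true Bool.≟ b ]· f (true ∷ y₀) ≡ f (b ∷ y₀)
    pick false = +i-identityʳ _
    pick true = +i-identityˡ _

  ∑El-bijection : ∀ n k (φ : El n → El k) (ψ : El k → El n) → (∀ x → ψ (φ x) ≡ x) → (∀ z → φ (ψ z) ≡ z) →
                  (f : El k → ℤi) → ∑El n (λ x → f (φ x)) ≡ ∑El k f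
  ∑El-bijection n k φ ψ ψφ φψ f = begin
    ∑El n (λ x → f (φ x))
      ≡⟨ ∑-cong (allEl n) (λ x → ∑El-point k (φ x) f) ⟨
    ∑El n (λ x → ∑El k (λ z → [ z ≟v φ x ]· f z))
      ≡⟨ ∑-comm (allEl n) (allEl k) _ ⟩
    ∑El k (λ z → ∑El n (λ x → [ z ≟v φ x ]· f z))
      ≡⟨ ∑-cong (allEl k) (λ z → ∑-cong (allEl n) (λ x →
           []·-⇔ (z ≟v φ x) (x ≟v ψ z) (λ { refl → sym (ψφ x) }) (λ { refl → sym (φψ z) }))) ⟩
    ∑El k (λ z → ∑El n (λ x → [ x ≟v ψ z ]· f z))
      ≡⟨ ∑-cong (allEl k) (λ z → ∑El-point n (ψ z) (λ _ → f z)) ⟩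
    ∑El k f ∎

  ∑El-isometry : ∀ {n k} {q₁ : QuadFn n} {q₂ : QuadFn k} (g : Isometry q₁ q₂) (f : El k → ℤi) →
                 ∑El n (λ x → f (fun g x)) ≡ ∑El k f
  ∑El-isometry {n} {k} g = ∑El-bijection n k (fun g) (inv g) (inv-fun g) (fun-inv g)

  ∑El-one : ∀ n → ∑El n (λ _ → (+ 1 , + 0)) ≡ (+ (2 ^ n) , + 0)
  ∑El-one zero = refl
  ∑El-one (suc n) = trans (∑El-suc n _) (trans (cong (λ t → t +i t) (∑El-one n))
                                               (cong (λ t → (+ (2 ^ n + t) , + 0)) (sym (ℕ.+-identityʳ (2 ^ n)))))

size-isometry : ∀ {n k} {q₁ : QuadFn n} {q₂ : QuadFn k} → Isometry q₁ q₂ → 2 ^ n ≡ 2 ^ k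
size-isometry {n} {k} g =
  ℤ.+-injective (cong proj₁ (trans (sym (∑El-one n)) (trans (∑El-isometry g _) (∑El-one k))))

-- Sums written, as in Defs, by a local function go that splits on P? y with `with`.
filtered-sum : ∀ {P : A → Set} (P? : ∀ y → Dec (P y)) (f : A → ℤi)
  (go : List A → ℤi) (go-with : (y : A) → List A → Dec (P y) → ℤi) →
  go [] ≡ 0i → (∀ y ys → go (y ∷ ys) ≡ go-with y ys (P? y)) →
  (∀ y ys p → go-with y ys (yes p) ≡ f y +i go ys) → (∀ y ys ¬p → go-with y ys (no ¬p) ≡ go ys) →
  (∀ y ys d → go-with y ys d ≡ [ d ]· f y +i go ys) × (∀ L → go L ≡ ∑ L (λ y → [ P? y ]· f y))
filtered-sum P? f go go-with go-[] go-∷ go-yes go-no = go-with-≡ , go-≡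
  where
  go-with-≡ : ∀ y ys d → go-with y ys d ≡ [ d ]· f y +i go ys
  go-with-≡ y ys (yes p) = go-yes y ys p
  go-with-≡ y ys (no ¬p) = trans (go-no y ys ¬p) (sym (+i-identityˡ (go ys)))

  go-≡ : ∀ L → go L ≡ ∑ L (λ y → [ P? y ]· f y)
  go-≡ [] = go-[]
  go-≡ (y ∷ ys) = trans (go-∷ y ys) (trans (go-with-≡ y ys (P? y)) (cong ([ P? y ]· f y +i_) (go-≡ ys)))

allEl-complete : ∀ {n} (x : El n) → x ∈ allEl n
allEl-complete [] = here refl
allEl-complete {suc n} (false ∷ x) = ∈-++⁺ˡ (∈-map⁺ (false ∷_) (allEl-complete x))
allEl-complete {suc n} (true ∷ x) = ∈-++⁺ʳ (map (false ∷_) (allEl n)) (∈-map⁺ (true ∷_) (allEl-complete x))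

-- G(A, O(A)) as a sum over a transversal of the orbits

module OrbitSums {n : ℕ} (q : QuadFn n) (orb? : ∀ x y → Dec (Orbit q x y)) where
  open ≡-Reasoning

  orbitSum∑ : El n → ℤi
  orbitSum∑ x = ∑El n (λ y → [ orb? x y ]· e (bil q x y))

  -- The clauses pin down, by unification, the local functions through which Defs computes orbitSum.
  orbitSum-≡ : ∀ x → orbitSum q orb? x ≡ orbitSum∑ x
  orbitSum-≡ x with allEl n
                  | filtered-sum (orb? x) (λ y → e (bil q x y)) _ _ refl (λ _ _ → refl) (λ _ _ _ → refl) (λ _ _ _ → refl)
  ... | [] | _ , go≡∑ = go≡∑ []
  ... | y ∷ ys | go-with≡ , go≡∑ with orb? x y
  ...   | d = trans (go-with≡ y ys d) (cong ([ d ]· e (bil q x y) +i_) (go≡∑ ys))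

  -- R meets every orbit exactly once.
  Transversal : List (El n) → Set
  Transversal R = ∀ t a → ∑ R (λ r → [ orb? r t ]· a) ≡ a

  private
    Seen : List (El n) → El n → Set
    Seen L t = Any (λ z → Orbit q z t) L

    Count : List (El n) → El n → ℤi → ℤi
    Count R t a = ∑ R (λ r → [ orb? r t ]· a)

  repsGo-count : ∀ seen xs t a →
    (Seen seen t → Count (repsGo q orb? seen xs) t a ≡ 0i) ×
    (¬ Seen seen t → Seen xs t → Count (repsGo q orb? seen xs) t a ≡ a)
  repsGo-count seen [] t a = (λ _ → refl) , (λ _ ())
  repsGo-count seen (y ∷ ys) t a with any? (λ z → orb? z y) seen
  ... | yes seen-y = proj₁ (repsGo-count seen ys t a) , new
    where
    new : ¬ Seen seen t → Seen (y ∷ ys) t → Count (repsGo q orb? seen ys) t a ≡ a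
    new ¬seen (here y~t) = ⊥-elim (¬seen (Any.map (λ z~y → orbit-trans z~y y~t) seen-y))
    new ¬seen (there h) = proj₂ (repsGo-count seen ys t a) ¬seen h
  ... | no ¬seen-y = old , new
    where
    old : Seen seen t → [ orb? y t ]· a +i Count (repsGo q orb? (y ∷ seen) ys) t a ≡ 0i
    old seen-t = trans (cong₂ _+i_ ([no]· (orb? y t) (λ y~t → ¬seen-y (Any.map (λ z~t → orbit-trans z~t (orbit-sym y~t)) seen-t)))
                                    (proj₁ (repsGo-count (y ∷ seen) ys t a) (there seen-t)))
                       (+i-identityˡ 0i)
    new : ¬ Seen seen t → Seen (y ∷ ys) t → [ orb? y t ]· a +i Count (repsGo q orb? (y ∷ seen) ys) t a ≡ a
    new ¬seen h with orb? y t
    ... | yes y~t = trans (cong (a +i_) (proj₁ (repsGo-count (y ∷ seen) ys t a) (here y~t))) (+i-identityʳ a)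
    ... | no ¬y~t = trans (+i-identityˡ _)
                      (proj₂ (repsGo-count (y ∷ seen) ys t a) (λ { (here y~t) → ¬y~t y~t ; (there p) → ¬seen p }) (drop-here h))
      where
      drop-here : Seen (y ∷ ys) t → Seen ys t
      drop-here (here y~t) = ⊥-elim (¬y~t y~t)
      drop-here (there p) = p

  repsGo-transversal : Transversal (repsGo q orb? [] (allEl n))
  repsGo-transversal t a = proj₂ (repsGo-count [] (allEl n) t a) (λ ()) (lose (allEl-complete t) orbit-refl)

  transversal-∑ : ∀ R R' (S : El n → ℤi) → (∀ {x y} → Orbit q x y → S x ≡ S y) →
                  Transversal R → Transversal R' → ∑ R S ≡ ∑ R' S
  transversal-∑ R R' S S-inv R-tr R'-tr = begin
    ∑ R S                                          ≡⟨ ∑-cong R (λ r → R'-tr r (S r)) ⟨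
    ∑ R (λ r → ∑ R' (λ r' → [ orb? r' r ]· S r))   ≡⟨ ∑-comm R R' _ ⟩
    ∑ R' (λ r' → ∑ R (λ r → [ orb? r' r ]· S r))   ≡⟨ ∑-cong R' (λ r' → ∑-cong R (λ r → swap r r')) ⟩
    ∑ R' (λ r' → ∑ R (λ r → [ orb? r r' ]· S r'))  ≡⟨ ∑-cong R' (λ r' → R-tr r' (S r')) ⟩
    ∑ R' S                                         ∎
    where
    swap : ∀ r r' → [ orb? r' r ]· S r ≡ [ orb? r r' ]· S r'
    swap r r' with orb? r' r
    ... | yes r'~r = sym (trans ([yes]· (orb? r r') (orbit-sym r'~r)) (S-inv r'~r))
    ... | no ¬r'~r = sym ([no]· (orb? r r') (λ r~r' → ¬r'~r (orbit-sym r~r')))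

  orbitSum∑-invariant : ∀ {x y} → Orbit q x y → orbitSum∑ x ≡ orbitSum∑ y
  orbitSum∑-invariant {x} (g , refl) = begin
    ∑El n (λ z → [ orb? x z ]· e (bil q x z))
      ≡⟨ ∑-cong (allEl n) (λ z → trans ([]·-cong (orb? x z) (cong e (sym (bil-fun g x z))))
           ([]·-⇔ (orb? x z) (orb? (fun g x) (fun g z)) (translate g)
           (λ o → subst₂ (Orbit q) (inv-fun g x) (inv-fun g z) (translate (isometry⁻¹ g) o)))) ⟩
    ∑El n (λ z → [ orb? (fun g x) (fun g z) ]· e (bil q (fun g x) (fun g z)))
      ≡⟨ ∑El-isometry g (λ w → [ orb? (fun g x) w ]· e (bil q (fun g x) w)) ⟩
    ∑El n (λ w → [ orb? (fun g x) w ]· e (bil q (fun g x) w)) ∎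
    where
    translate : ∀ {x z} (h : Isometry q q) → Orbit q x z → Orbit q (fun h x) (fun h z)
    translate h x~z = orbit-trans (orbit-sym (h , refl)) (orbit-trans x~z (h , refl))

  G-transversal : ∀ R → Transversal R → G q orb? ≡ ∑ R orbitSum∑
  G-transversal R R-tr = trans (sumOver-≡ (repsGo q orb? [] (allEl n)))
                               (transversal-∑ _ R orbitSum∑ orbitSum∑-invariant repsGo-transversal R-tr)
    where
    sumOver-≡ : ∀ xs → sumOver q orb? xs ≡ ∑ xs orbitSum∑
    sumOver-≡ [] = refl
    sumOver-≡ (x ∷ xs) = cong₂ _+i_ (orbitSum-≡ x) (sumOver-≡ xs)

-- Gauss sums over the level sets of q

-- sign c X = e(2c) X.
sign : Z4 → ℤi → ℤi
sign z0 X = X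
sign z1 X = -i X
sign z2 X = X
sign z3 X = -i X

sign-+i : ∀ c X Y → sign c (X +i Y) ≡ sign c X +i sign c Y
sign-+i z0 X Y = refl
sign-+i z1 X Y = sym (-i-+i-comm X Y)
sign-+i z2 X Y = refl
sign-+i z3 X Y = sym (-i-+i-comm X Y)

∑-sign : ∀ c L (f : A → ℤi) → ∑ L (λ y → sign c (f y)) ≡ sign c (∑ L f)
∑-sign z0 L f = refl
∑-sign z1 L f = ∑--i L f
∑-sign z2 L f = refl
∑-sign z3 L f = ∑--i L f

e-+₄z2 : ∀ a → e (a +₄ z2) ≡ -i e a
e-+₄z2 = decide (∀₄? λ a → _ ≟i _)

e--₄2· : ∀ a c → e (a -₄ (2 ·₄ c)) ≡ sign c (e a)
e--₄2· = decide (∀₄? λ a → ∀₄? λ c → _ ≟i _)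

four-indicator : ∀ a c b → four ([ a ≟₄ c ]· e b) ≡
  ((e ((0 ·₄ (a -₄ c)) +₄ b) +i e ((1 ·₄ (a -₄ c)) +₄ b)) +i e ((2 ·₄ (a -₄ c)) +₄ b)) +i e ((3 ·₄ (a -₄ c)) +₄ b)
four-indicator = decide (∀₄? λ a → ∀₄? λ c → ∀₄? λ b → _ ≟i _)

∑El-antiperiodic : ∀ n (χ : El n → Z4) t → (∀ y → χ (y ⊕v t) ≡ χ y +₄ z2) → ∑El n (λ y → e (χ y)) ≡ 0i
∑El-antiperiodic n χ t shift = self-negating _ (begin
  ∑El n (λ y → e (χ y))              ≡⟨ ∑El-translate n t (λ y → e (χ y)) ⟨
  ∑El n (λ y → e (χ (y ⊕v t)))       ≡⟨ ∑-cong (allEl n) (λ y → trans (cong e (shift y)) (e-+₄z2 (χ y))) ⟩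
  ∑El n (λ y → -i e (χ y))           ≡⟨ ∑--i (allEl n) (λ y → e (χ y)) ⟩
  -i ∑El n (λ y → e (χ y))           ∎)
  where open ≡-Reasoning

module Gauss {n : ℕ} {q : QuadFn n} (F : IsFQF q) where
  open FQF F
  open ≡-Reasoning

  γ γ₃ : ℤi
  γ = ∑El n (λ y → e (q y))
  γ₃ = ∑El n (λ y → e (3 ·₄ q y))

  sphere : El n → ℤi
  sphere x = ∑El n (λ y → [ q y ≟₄ q x ]· e (bil q x y))

  ∑-bil-nonzero : ∀ x → ¬ x ≡ 0v → ∑El n (λ y → e (bil q x y)) ≡ 0i
  ∑-bil-nonzero x x≢0 = ∑El-antiperiodic n (bil q x) t (λ y → trans (linʳ x y t) (cong (bil q x y +₄_) bil-xt))
    where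
    t : El n
    t = proj₁ (nondeg-witness x x≢0)
    bil-xt : bil q x t ≡ z2
    bil-xt = proj₂ (nondeg-witness x x≢0)

  ∑-twice-noncharacteristic : ∀ x → ¬ IsCharacteristic q x →
    ∑El n (λ y → e ((2 ·₄ (q y -₄ q x)) +₄ bil q x y)) ≡ 0i
  ∑-twice-noncharacteristic x x-nonchar = ∑El-antiperiodic n _ t shift
    where
    t : El n
    t = proj₁ (noncharacteristic-witness x x-nonchar)
    2qt+bil-xt : (2 ·₄ q t) +₄ bil q x t ≡ z2
    2qt+bil-xt = decide (∀₄? λ a → ∀₄? λ b → even? b →-dec ¬? (b ≟₄ 2 ·₄ a) →-dec ((2 ·₄ a) +₄ b ≟₄ z2))
                   (q t) _ (bil-even x t) (λ h → proj₂ (noncharacteristic-witness x x-nonchar) (trans (symm t x) h))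
    shift : ∀ y → (2 ·₄ (q (y ⊕v t) -₄ q x)) +₄ bil q x (y ⊕v t) ≡ ((2 ·₄ (q y -₄ q x)) +₄ bil q x y) +₄ z2
    shift y = trans (cong₂ (λ a b → (2 ·₄ (a -₄ q x)) +₄ b) (q-⊕ y t) (linʳ x y t))
      (decide (∀₄? λ a → ∀₄? λ s → ∀₄? λ c → ∀₄? λ B → ∀₄? λ X → ∀₄? λ Y →
                 even? B →-dec even? X →-dec even? Y →-dec ((2 ·₄ s) +₄ Y ≟₄ z2) →-dec
                 ((2 ·₄ (((a +₄ s) +₄ B) -₄ c)) +₄ (X +₄ Y) ≟₄ ((2 ·₄ (a -₄ c)) +₄ X) +₄ z2))
         (q y) (q t) (q x) _ _ _ (bil-even y t) (bil-even x y) (bil-even x t) 2qt+bil-xt)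

  ∑-odd-multiple : ∀ k →
    (∀ a c B → Even B → (k ·₄ (((a +₄ c) +₄ B) -₄ c)) +₄ (B +₄ (2 ·₄ c)) ≡ (k ·₄ a) -₄ (2 ·₄ c)) →
    ∀ x → ∑El n (λ y → e ((k ·₄ (q y -₄ q x)) +₄ bil q x y)) ≡ sign (q x) (∑El n (λ y → e (k ·₄ q y)))
  ∑-odd-multiple k arith x = begin
    ∑El n (λ y → e ((k ·₄ (q y -₄ q x)) +₄ bil q x y))
      ≡⟨ ∑El-translate n x _ ⟨
    ∑El n (λ y → e ((k ·₄ (q (y ⊕v x) -₄ q x)) +₄ bil q x (y ⊕v x)))
      ≡⟨ ∑-cong (allEl n) (λ y → cong e (shift y)) ⟩
    ∑El n (λ y → e ((k ·₄ q y) -₄ (2 ·₄ q x)))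
      ≡⟨ ∑-cong (allEl n) (λ y → e--₄2· (k ·₄ q y) (q x)) ⟩
    ∑El n (λ y → sign (q x) (e (k ·₄ q y)))
      ≡⟨ ∑-sign (q x) (allEl n) _ ⟩
    sign (q x) (∑El n (λ y → e (k ·₄ q y))) ∎
    where
    shift : ∀ y → (k ·₄ (q (y ⊕v x) -₄ q x)) +₄ bil q x (y ⊕v x) ≡ (k ·₄ q y) -₄ (2 ·₄ q x)
    shift y = trans (cong₂ (λ a b → (k ·₄ (a -₄ q x)) +₄ b)
                           (trans (q-⊕ y x) (cong ((q y +₄ q x) +₄_) (symm y x)))
                           (trans (linʳ x y x) (cong (bil q x y +₄_) (bil-self x))))
                    (arith (q y) (q x) (bil q x y) (bil-even x y))

  four-sphere : ∀ x → Generic q x → four (sphere x) ≡ sign (q x) (γ +i γ₃)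
  four-sphere x (x≢0 , x-nonchar) = begin
    four (sphere x)
      ≡⟨ ∑-four (allEl n) _ ⟨
    ∑El n (λ y → four ([ q y ≟₄ q x ]· e (bil q x y)))
      ≡⟨ ∑-cong (allEl n) (λ y → four-indicator (q y) (q x) (bil q x y)) ⟩
    ∑El n (λ y → ((A₀ y +i A₁ y) +i A₂ y) +i A₃ y)
      ≡⟨ trans (∑-+i (allEl n) _ A₃) (cong (_+i ∑El n A₃)
           (trans (∑-+i (allEl n) _ A₂) (cong (_+i ∑El n A₂) (∑-+i (allEl n) A₀ A₁)))) ⟩
    ((∑El n A₀ +i ∑El n A₁) +i ∑El n A₂) +i ∑El n A₃
      ≡⟨ cong₂ (λ s t → ((s +i ∑El n A₁) +i t) +i ∑El n A₃)
               (∑-bil-nonzero x x≢0) (∑-twice-noncharacteristic x x-nonchar) ⟩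
    ((0i +i ∑El n A₁) +i 0i) +i ∑El n A₃
      ≡⟨ cong (_+i ∑El n A₃) (trans (+i-identityʳ (0i +i ∑El n A₁)) (+i-identityˡ (∑El n A₁))) ⟩
    ∑El n A₁ +i ∑El n A₃
      ≡⟨ cong₂ _+i_ (∑-odd-multiple 1 (decide (∀₄? λ a → ∀₄? λ c → ∀₄? λ B → even? B →-dec (_ ≟₄ _))) x)
           (∑-odd-multiple 3 (decide (∀₄? λ a → ∀₄? λ c → ∀₄? λ B → even? B →-dec (_ ≟₄ _))) x) ⟩
    sign (q x) (∑El n (λ y → e (1 ·₄ q y))) +i sign (q x) γ₃
      ≡⟨ cong (λ t → sign (q x) t +i sign (q x) γ₃)
           (∑-cong (allEl n) (λ y → cong e (+₄-identityʳ (q y)))) ⟩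
    sign (q x) γ +i sign (q x) γ₃
      ≡⟨ sign-+i (q x) γ γ₃ ⟨
    sign (q x) (γ +i γ₃) ∎
    where
    A₀ A₁ A₂ A₃ : El n → ℤi
    A₀ y = e (bil q x y)
    A₁ y = e ((1 ·₄ (q y -₄ q x)) +₄ bil q x y)
    A₂ y = e ((2 ·₄ (q y -₄ q x)) +₄ bil q x y)
    A₃ y = e ((3 ·₄ (q y -₄ q x)) +₄ bil q x y)

γ-isometry : ∀ {n k} {q₁ : QuadFn n} {q₂ : QuadFn k} → Isometry q₁ q₂ →
             ∑El n (λ x → e (q₁ x)) ≡ ∑El k (λ v → e (q₂ v))
γ-isometry {n} {k} {q₁} {q₂} g =
  trans (∑-cong (allEl n) (λ x → cong e (sym (preserve g x)))) (∑El-isometry g (λ v → e (q₂ v)))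

module _ where
  open ≡-Reasoning

  γ-U⊕ : ∀ k (qB : QuadFn k) → ∑El (2 + k) (λ v → e ((qU ⊕q qB) v)) ≡ ∑El k (λ v → e (qB v)) +i ∑El k (λ v → e (qB v))
  γ-U⊕ k qB = begin
    ∑El (2 + k) (λ v → e ((qU ⊕q qB) v))
      ≡⟨ ∑El-suc (suc k) _ ⟩
    ∑El (suc k) (λ v → e ((qU ⊕q qB) (false ∷ v))) +i ∑El (suc k) (λ v → e ((qU ⊕q qB) (true ∷ v)))
      ≡⟨ cong₂ _+i_ (∑El-suc k _) (∑El-suc k _) ⟩
    (X +i X) +i (X +i ∑El k (λ v → e (z2 +₄ qB v)))
      ≡⟨ cong (λ t → (X +i X) +i (X +i t)) (trans (∑-cong (allEl k) (λ v → e-z2+₄ (qB v))) (∑--i (allEl k) _)) ⟩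
    (X +i X) +i (X +i (-i X))
      ≡⟨ cong ((X +i X) +i_) (+i-inverseʳ X) ⟩
    (X +i X) +i 0i
      ≡⟨ +i-identityʳ (X +i X) ⟩
    X +i X ∎
    where
    X : ℤi
    X = ∑El k (λ v → e (qB v))
    e-z2+₄ : ∀ a → e (z2 +₄ a) ≡ -i e a
    e-z2+₄ = decide (∀₄? λ a → _ ≟i _)

  γ-Upow : ∀ m → ∑El (dbl m) (λ v → e (Upow m v)) ≡ (+ (2 ^ m) , + 0)
  γ-Upow zero = refl
  γ-Upow (suc m) = trans (γ-U⊕ (dbl m) (Upow m))
    (trans (cong (λ t → t +i t) (γ-Upow m)) (cong (λ t → (+ (2 ^ m + t) , + 0)) (sym (ℕ.+-identityʳ (2 ^ m)))))

  γ-⊕V : ∀ k (h : El k → Z4) → ∑El (k + 2) (λ v → e (h (take k v) +₄ qV (drop k v))) ≡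
         -i (∑El k (λ v → e (h v)) +i ∑El k (λ v → e (h v)))
  γ-⊕V zero h = decide (∀₄? λ a →
    e (a +₄ z0) +i (e (a +₄ z2) +i (e (a +₄ z2) +i (e (a +₄ z2) +i 0i))) ≟i -i ((e a +i 0i) +i (e a +i 0i))) (h [])
  γ-⊕V (suc k) h = begin
    ∑El (suc (k + 2)) (λ v → e (h (take (suc k) v) +₄ qV (drop (suc k) v)))
      ≡⟨ ∑El-suc (k + 2) _ ⟩
    ∑El (k + 2) (λ v → e (h (false ∷ take k v) +₄ qV (drop k v)))
      +i ∑El (k + 2) (λ v → e (h (true ∷ take k v) +₄ qV (drop k v)))
      ≡⟨ cong₂ _+i_ (γ-⊕V k (λ v → h (false ∷ v))) (γ-⊕V k (λ v → h (true ∷ v))) ⟩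
    (-i (X₀ +i X₀)) +i (-i (X₁ +i X₁))
      ≡⟨ -i-+i-comm (X₀ +i X₀) (X₁ +i X₁) ⟩
    -i ((X₀ +i X₀) +i (X₁ +i X₁))
      ≡⟨ cong -i_ (+i-interchange X₀ X₀ X₁ X₁) ⟩
    -i ((X₀ +i X₁) +i (X₀ +i X₁))
      ≡⟨ cong (λ t → -i (t +i t)) (∑El-suc k (λ v → e (h v))) ⟨
    -i (∑El (suc k) (λ v → e (h v)) +i ∑El (suc k) (λ v → e (h v))) ∎
    where
    X₀ X₁ : ℤi
    X₀ = ∑El k (λ v → e (h (false ∷ v)))
    X₁ = ∑El k (λ v → e (h (true ∷ v)))

  γ-UpowV : ∀ m → ∑El (dbl m + 2) (λ v → e ((Upow m ⊕q qV) v)) ≡ -i (+ (2 ^ suc m) , + 0)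
  γ-UpowV m = trans (γ-⊕V (dbl m) (Upow m))
    (cong -i_ (trans (cong (λ t → t +i t) (γ-Upow m)) (cong (λ t → (+ (2 ^ m + t) , + 0)) (sym (ℕ.+-identityʳ (2 ^ m))))))

∑-filter : ∀ {P : A → Set} (P? : ∀ x → Dec (P x)) L (f : A → ℤi) → ∑ (filter P? L) f ≡ ∑ L (λ y → [ P? y ]· f y)
∑-filter P? [] f = refl
∑-filter P? (y ∷ ys) f with P? y
... | yes _ = cong (f y +i_) (∑-filter P? ys f)
... | no _ = trans (∑-filter P? ys f) (sym (+i-identityˡ _))

∑-cong-All : ∀ {P : A → Set} {L} {f g : A → ℤi} → All P L → (∀ x → P x → f x ≡ g x) → ∑ L f ≡ ∑ L g
∑-cong-All [] h = refl
∑-cong-All (px ∷ pxs) h = cong₂ _+i_ (h _ px) (∑-cong-All pxs h)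

[¬]·+[]· : ∀ {P : Set} (d : Dec P) a → [ ¬? d ]· a +i [ d ]· a ≡ a
[¬]·+[]· (yes _) a = +i-identityˡ a
[¬]·+[]· (no _) a = +i-identityʳ a

-- G(A, O(A)) when O(A) is transitive on the generic vectors of each norm

module LevelSums {n : ℕ} {q : QuadFn n} (F : IsFQF q) (orb? : ∀ x y → Dec (Orbit q x y))
                 (transitive : ∀ {x y} → Generic q x → Generic q y → q x ≡ q y → Orbit q x y) where
  open FQF F
  open Gauss F
  open OrbitSums q orb?
  open ≡-Reasoning

  nonGeneric? : ∀ y → Dec (¬ Generic q y)
  nonGeneric? y = ¬? (generic? y)

  nonGeneric : List (El n)
  nonGeneric = filter nonGeneric? (allEl n)

  nonGeneric-cases : ∀ {y} → ¬ Generic q y → y ≡ 0v ⊎ IsCharacteristic q y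
  nonGeneric-cases {y} ng with y ≟v 0v
  ... | yes y≡0 = inj₁ y≡0
  ... | no y≢0 = inj₂ (decidable-stable (isCharacteristic? y) (λ y-nonchar → ng (y≢0 , y-nonchar)))

  nonGeneric-orbit : ∀ {y z} → ¬ Generic q y → Orbit q y z → z ≡ y
  nonGeneric-orbit ng y~z with nonGeneric-cases ng
  ... | inj₁ refl = orbit-0v y~z
  ... | inj₂ hy = characteristic-unique (orbit-characteristic y~z hy) hy

  bil-nonGeneric : ∀ {g y} → ¬ Generic q y → q y ≡ q g → bil q g y ≡ 2 ·₄ q y
  bil-nonGeneric {g} {y} ng qy≡qg with nonGeneric-cases ng
  ... | inj₁ refl = trans (bil-0ʳ g) (cong (2 ·₄_) (sym q-0v))
  ... | inj₂ hy = trans (hy g) (cong (2 ·₄_) (sym qy≡qg))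

  orbitSum∑-nonGeneric : ∀ {y} → ¬ Generic q y → orbitSum∑ y ≡ e (2 ·₄ q y)
  orbitSum∑-nonGeneric {y} ng = begin
    ∑El n (λ z → [ orb? y z ]· e (bil q y z))
      ≡⟨ ∑-cong (allEl n) (λ z → []·-⇔ (orb? y z) (z ≟v y) (nonGeneric-orbit ng) (λ { refl → orbit-refl })) ⟩
    ∑El n (λ z → [ z ≟v y ]· e (bil q y z))   ≡⟨ ∑El-point n y _ ⟩
    e (bil q y y)                            ≡⟨ cong e (bil-self y) ⟩
    e (2 ·₄ q y)                             ∎

  ∑-nonGeneric-orbitSum∑ : ∑ nonGeneric orbitSum∑ ≡ ∑ nonGeneric (λ y → e (2 ·₄ q y))
  ∑-nonGeneric-orbitSum∑ = begin
    ∑ nonGeneric orbitSum∑                          ≡⟨ ∑-filter nonGeneric? (allEl n) orbitSum∑ ⟩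
    ∑El n (λ y → [ nonGeneric? y ]· orbitSum∑ y)     ≡⟨ ∑-cong (allEl n) value ⟩
    ∑El n (λ y → [ nonGeneric? y ]· e (2 ·₄ q y))    ≡⟨ ∑-filter nonGeneric? (allEl n) _ ⟨
    ∑ nonGeneric (λ y → e (2 ·₄ q y))               ∎
    where
    value : ∀ y → [ nonGeneric? y ]· orbitSum∑ y ≡ [ nonGeneric? y ]· e (2 ·₄ q y)
    value y with nonGeneric? y
    ... | yes ng = orbitSum∑-nonGeneric ng
    ... | no _ = refl

  count-nonGeneric : ∀ t a → ∑ nonGeneric (λ r → [ orb? r t ]· a) ≡ [ nonGeneric? t ]· a
  count-nonGeneric t a = begin
    ∑ nonGeneric (λ r → [ orb? r t ]· a)                   ≡⟨ ∑-filter nonGeneric? (allEl n) _ ⟩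
    ∑El n (λ r → [ nonGeneric? r ]· [ orb? r t ]· a)       ≡⟨ ∑-cong (allEl n) only-t ⟩
    ∑El n (λ r → [ r ≟v t ]· [ nonGeneric? t ]· a)         ≡⟨ ∑El-point n t _ ⟩
    [ nonGeneric? t ]· a                                   ∎
    where
    only-t : ∀ r → [ nonGeneric? r ]· [ orb? r t ]· a ≡ [ r ≟v t ]· [ nonGeneric? t ]· a
    only-t r with nonGeneric? r | orb? r t | r ≟v t
    ... | yes ng | yes _ | yes refl = sym ([yes]· (nonGeneric? r) ng)
    ... | no g | yes _ | yes refl = sym ([no]· (nonGeneric? r) g)
    ... | _ | no ¬r~r | yes refl = ⊥-elim (¬r~r orbit-refl)
    ... | yes ng | yes r~t | no r≢t = ⊥-elim (r≢t (sym (nonGeneric-orbit ng r~t)))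
    ... | yes _ | no _ | no _ = refl
    ... | no _ | _ | no _ = refl

  LevelTransversal : List (El n) → Set
  LevelTransversal Gs = ∀ t a → ∑ Gs (λ g → [ q g ≟₄ q t ]· a) ≡ a

  module _ (Gs : List (El n)) (Gs-generic : All (Generic q) Gs) (Gs-levels : LevelTransversal Gs) where

    count-Gs : ∀ t a → ∑ Gs (λ g → [ orb? g t ]· a) ≡ [ generic? t ]· a
    count-Gs t a with generic? t
    ... | yes gt = trans (∑-cong-All Gs-generic (λ g gg → []·-⇔ (orb? g t) (q g ≟₄ q t) orbit-q (transitive gg gt))) (Gs-levels t a)
    ... | no ¬gt = trans (∑-cong-All {g = λ _ → 0i} Gs-generic (λ g gg → [no]· (orb? g t) (λ g~t → ¬gt (orbit-generic g~t gg))))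
                         (∑-zero Gs (λ _ → refl))

    transversal : Transversal (nonGeneric ++ Gs)
    transversal t a = begin
      ∑ (nonGeneric ++ Gs) (λ r → [ orb? r t ]· a)
        ≡⟨ ∑-++ nonGeneric Gs _ ⟩
      ∑ nonGeneric (λ r → [ orb? r t ]· a) +i ∑ Gs (λ r → [ orb? r t ]· a)
        ≡⟨ cong₂ _+i_ (count-nonGeneric t a) (count-Gs t a) ⟩
      [ nonGeneric? t ]· a +i [ generic? t ]· a
        ≡⟨ [¬]·+[]· (generic? t) a ⟩
      a ∎

    nonGenericPart : El n → ℤi
    nonGenericPart x = ∑El n (λ y → [ nonGeneric? y ]· [ q y ≟₄ q x ]· e (bil q x y))

    sphere-split : ∀ x → Generic q x → sphere x ≡ orbitSum∑ x +i nonGenericPart x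
    sphere-split x gx = trans (∑-cong (allEl n) pointwise) (∑-+i (allEl n) _ _)
      where
      pointwise : ∀ y → [ q y ≟₄ q x ]· e (bil q x y)
                      ≡ [ orb? x y ]· e (bil q x y) +i [ nonGeneric? y ]· [ q y ≟₄ q x ]· e (bil q x y)
      pointwise y with orb? x y | nonGeneric? y
      ... | yes x~y | yes ng = ⊥-elim (ng (orbit-generic x~y gx))
      ... | yes x~y | no _ = trans ([yes]· (q y ≟₄ q x) (sym (orbit-q x~y))) (sym (+i-identityʳ _))
      ... | no _ | yes _ = sym (+i-identityˡ _)
      ... | no ¬x~y | no ¬ng = [no]· (q y ≟₄ q x) (λ qy≡qx → ¬x~y (transitive gx (decidable-stable (generic? y) ¬ng) (sym qy≡qx)))

    ∑-nonGenericPart : ∑ Gs nonGenericPart ≡ ∑ nonGeneric (λ y → e (2 ·₄ q y))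
    ∑-nonGenericPart = begin
      ∑ Gs (λ g → ∑El n (λ y → [ nonGeneric? y ]· [ q y ≟₄ q g ]· e (bil q g y)))
        ≡⟨ ∑-comm Gs (allEl n) _ ⟩
      ∑El n (λ y → ∑ Gs (λ g → [ nonGeneric? y ]· [ q y ≟₄ q g ]· e (bil q g y)))
        ≡⟨ ∑-cong (allEl n) (λ y → ∑-cong Gs (λ g → level y g)) ⟩
      ∑El n (λ y → ∑ Gs (λ g → [ nonGeneric? y ]· [ q g ≟₄ q y ]· e (2 ·₄ q y)))
        ≡⟨ ∑-cong (allEl n) (λ y → ∑-[]· Gs (nonGeneric? y) _) ⟩
      ∑El n (λ y → [ nonGeneric? y ]· ∑ Gs (λ g → [ q g ≟₄ q y ]· e (2 ·₄ q y)))
        ≡⟨ ∑-cong (allEl n) (λ y → []·-cong (nonGeneric? y) (Gs-levels y _)) ⟩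
      ∑El n (λ y → [ nonGeneric? y ]· e (2 ·₄ q y))
        ≡⟨ ∑-filter nonGeneric? (allEl n) _ ⟨
      ∑ nonGeneric (λ y → e (2 ·₄ q y)) ∎
      where
      level : ∀ y g → [ nonGeneric? y ]· [ q y ≟₄ q g ]· e (bil q g y) ≡ [ nonGeneric? y ]· [ q g ≟₄ q y ]· e (2 ·₄ q y)
      level y g with nonGeneric? y | q y ≟₄ q g
      ... | no _ | _ = refl
      ... | yes ng | yes qy≡qg = trans (cong e (bil-nonGeneric ng qy≡qg)) (sym ([yes]· (q g ≟₄ q y) (sym qy≡qg)))
      ... | yes ng | no qy≢qg = sym ([no]· (q g ≟₄ q y) (λ qg≡qy → qy≢qg (sym qg≡qy)))

    G-levels : G q orb? ≡ ∑ Gs sphere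
    G-levels = begin
      G q orb?
        ≡⟨ G-transversal (nonGeneric ++ Gs) transversal ⟩
      ∑ (nonGeneric ++ Gs) orbitSum∑
        ≡⟨ ∑-++ nonGeneric Gs orbitSum∑ ⟩
      ∑ nonGeneric orbitSum∑ +i ∑ Gs orbitSum∑
        ≡⟨ cong (_+i ∑ Gs orbitSum∑) (trans ∑-nonGeneric-orbitSum∑ (sym ∑-nonGenericPart)) ⟩
      ∑ Gs nonGenericPart +i ∑ Gs orbitSum∑
        ≡⟨ +i-comm (∑ Gs nonGenericPart) (∑ Gs orbitSum∑) ⟩
      ∑ Gs orbitSum∑ +i ∑ Gs nonGenericPart
        ≡⟨ ∑-+i Gs orbitSum∑ nonGenericPart ⟨
      ∑ Gs (λ g → orbitSum∑ g +i nonGenericPart g)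
        ≡⟨ ∑-cong-All Gs-generic (λ g gg → sym (sphere-split g gg)) ⟩
      ∑ Gs sphere ∎

    four-G : four (G q orb?) ≡ ∑ Gs (λ g → sign (q g) (γ +i γ₃))
    four-G = begin
      four (G q orb?)                      ≡⟨ cong four G-levels ⟩
      four (∑ Gs sphere)                   ≡⟨ ∑-four Gs sphere ⟨
      ∑ Gs (λ g → four (sphere g))         ≡⟨ ∑-cong-All Gs-generic four-sphere ⟩
      ∑ Gs (λ g → sign (q g) (γ +i γ₃))    ∎

module Hyperbolic {n : ℕ} {q : QuadFn n} (F : IsFQF q) (orb? : ∀ x y → Dec (Orbit q x y))
                  (u₁ u₂ : El n) (q-u₁ : q u₁ ≡ z0) (q-u₂ : q u₂ ≡ z0) (bil-u₁u₂ : bil q u₁ u₂ ≡ z2) where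
  open FQF F
  open Gauss F
  open Witt F u₁ u₂ q-u₁ q-u₂ bil-u₁u₂ using (witt; bil-u₂u₁; bil-u₂u₂; ξ; ξ-⊥u₁; ξ-⊥u₂; 2q-ξ)
  open LevelSums F orb? witt
  open ≡-Reasoning

  q-u₁⊕u₂ : q (u₁ ⊕v u₂) ≡ z2
  q-u₁⊕u₂ = trans (q-⊕ u₁ u₂) (cong₃ (λ a b c → (a +₄ b) +₄ c) q-u₁ q-u₂ bil-u₁u₂)

  bil-u₂-u₁⊕u₂ : bil q u₂ (u₁ ⊕v u₂) ≡ z2
  bil-u₂-u₁⊕u₂ = trans (linʳ u₂ u₁ u₂) (cong₂ _+₄_ bil-u₂u₁ bil-u₂u₂)

  module _ (special : Special q) where

    q-even : ∀ y → Even (q y)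
    q-even y = even-if-2·₄-zero (q y) (trans (sym (special y)) (bil-0ʳ y))

    specialReps : List (El n)
    specialReps = u₁ ∷ (u₁ ⊕v u₂) ∷ []

    specialReps-generic : All (Generic q) specialReps
    specialReps-generic = generic-if-paired q-u₂ bil-u₂u₁ ∷ generic-if-paired q-u₂ bil-u₂-u₁⊕u₂ ∷ []

    specialReps-levels : LevelTransversal specialReps
    specialReps-levels t a =
      trans (cong₂ (λ s s' → [ s ≟₄ q t ]· a +i ([ s' ≟₄ q t ]· a +i 0i)) q-u₁ q-u₁⊕u₂) (levels (q-even t))
      where
      levels : ∀ {v} → Even v → [ z0 ≟₄ v ]· a +i ([ z2 ≟₄ v ]· a +i 0i) ≡ a
      levels even0 = trans (cong (a +i_) (+i-identityˡ 0i)) (+i-identityʳ a)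
      levels even2 = trans (+i-identityˡ (a +i 0i)) (+i-identityʳ a)

    γ₃≡γ : γ₃ ≡ γ
    γ₃≡γ = ∑-cong (allEl n) (λ y → cong e (decide (∀₄? λ a → even? a →-dec (3 ·₄ a ≟₄ a)) (q y) (q-even y)))

    G-special : G q orb? ≡ γ
    G-special = four-injective (G q orb?) γ (begin
      four (G q orb?)
        ≡⟨ four-G specialReps specialReps-generic specialReps-levels ⟩
      sign (q u₁) X +i (sign (q (u₁ ⊕v u₂)) X +i 0i)
        ≡⟨ cong₂ (λ s s' → sign s X +i (sign s' X +i 0i)) q-u₁ q-u₁⊕u₂ ⟩
      X +i (X +i 0i)
        ≡⟨ cong (X +i_) (+i-identityʳ X) ⟩
      X +i X
        ≡⟨ cong (λ t → (γ +i t) +i (γ +i t)) γ₃≡γ ⟩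
      four γ ∎)
      where
      X : ℤi
      X = γ +i γ₃

  module _ (nonspecial : ¬ Special q) where

    -- A vector of odd norm orthogonal to u₁ and u₂; it exists because 0 is not characteristic.
    β : El n
    β = ξ (proj₁ (noncharacteristic-witness 0v nonspecial))

    q-β-odd : Odd (q β)
    q-β-odd q-β-even = proj₂ (noncharacteristic-witness 0v nonspecial)
      (trans (bil-0ʳ t) (sym (trans (sym (2q-ξ t)) (2·₄-even-zero (q β) q-β-even))))
      where
      t : El n
      t = proj₁ (noncharacteristic-witness 0v nonspecial)

    bil-u₁-β : bil q u₁ β ≡ z0
    bil-u₁-β = trans (symm u₁ β) (ξ-⊥u₁ _)

    bil-u₂-β : bil q u₂ β ≡ z0
    bil-u₂-β = trans (symm u₂ β) (ξ-⊥u₂ _)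

    nonspecialReps : List (El n)
    nonspecialReps = u₁ ∷ (u₁ ⊕v u₂) ∷ (u₁ ⊕v β) ∷ ((u₁ ⊕v u₂) ⊕v β) ∷ []

    q-u₁⊕β : q (u₁ ⊕v β) ≡ q β
    q-u₁⊕β = trans (q-⊕ u₁ β) (trans (cong₂ (λ a b → (a +₄ q β) +₄ b) q-u₁ bil-u₁-β) (+₄-identityʳ (q β)))

    q-u₁⊕u₂⊕β : q ((u₁ ⊕v u₂) ⊕v β) ≡ z2 +₄ q β
    q-u₁⊕u₂⊕β = trans (q-⊕ (u₁ ⊕v u₂) β)
      (trans (cong₂ (λ a b → (a +₄ q β) +₄ b) q-u₁⊕u₂ (trans (linˡ u₁ u₂ β) (cong₂ _+₄_ bil-u₁-β bil-u₂-β)))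
             (+₄-identityʳ _))

    nonspecialReps-generic : All (Generic q) nonspecialReps
    nonspecialReps-generic = generic-if-paired q-u₂ bil-u₂u₁ ∷ generic-if-paired q-u₂ bil-u₂-u₁⊕u₂
                ∷ generic-if-paired q-u₂ (trans (linʳ u₂ u₁ β) (cong₂ _+₄_ bil-u₂u₁ bil-u₂-β))
                ∷ generic-if-paired q-u₂ (trans (linʳ u₂ (u₁ ⊕v u₂) β) (cong₂ _+₄_ bil-u₂-u₁⊕u₂ bil-u₂-β)) ∷ []

    ∑-nonspecialReps : ∀ (f : Z4 → ℤi) →
      ∑ nonspecialReps (λ g → f (q g)) ≡ f z0 +i (f z2 +i (f (q β) +i (f (z2 +₄ q β) +i 0i)))
    ∑-nonspecialReps f =
      cong₂ _+i_ (cong f q-u₁) (cong₂ _+i_ (cong f q-u₁⊕u₂) (cong₂ _+i_ (cong f q-u₁⊕β) (cong (_+i 0i) (cong f q-u₁⊕u₂⊕β))))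

    nonspecialReps-levels : LevelTransversal nonspecialReps
    nonspecialReps-levels t a = trans (∑-nonspecialReps (λ w → [ w ≟₄ q t ]· a)) (levels (q β) (q t) q-β-odd)
      where
      levels : ∀ c v → Odd c →
               [ z0 ≟₄ v ]· a +i ([ z2 ≟₄ v ]· a +i ([ c ≟₄ v ]· a +i ([ z2 +₄ c ≟₄ v ]· a +i 0i))) ≡ a
      levels z1 z0 _ = +i-identityʳ a
      levels z1 z2 _ = trans (+i-identityˡ _) (+i-identityʳ a)
      levels z1 z1 _ = trans (+i-identityˡ _) (trans (+i-identityˡ _) (+i-identityʳ a))
      levels z1 z3 _ = trans (+i-identityˡ _) (trans (+i-identityˡ _) (trans (+i-identityˡ _) (+i-identityʳ a)))
      levels z3 z0 _ = +i-identityʳ a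
      levels z3 z2 _ = trans (+i-identityˡ _) (+i-identityʳ a)
      levels z3 z3 _ = trans (+i-identityˡ _) (trans (+i-identityˡ _) (+i-identityʳ a))
      levels z3 z1 _ = trans (+i-identityˡ _) (trans (+i-identityˡ _) (trans (+i-identityˡ _) (+i-identityʳ a)))
      levels z0 v odd = ⊥-elim (odd even0)
      levels z2 v odd = ⊥-elim (odd even2)

    G-nonspecial : G q orb? ≡ 0i
    G-nonspecial = four-zero (G q orb?) (begin
      four (G q orb?)
        ≡⟨ four-G nonspecialReps nonspecialReps-generic nonspecialReps-levels ⟩
      ∑ nonspecialReps (λ g → sign (q g) X)
        ≡⟨ ∑-nonspecialReps (λ w → sign w X) ⟩
      X +i (X +i (sign (q β) X +i (sign (z2 +₄ q β) X +i 0i)))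
        ≡⟨ cong₂ (λ s s' → X +i (X +i (s +i (s' +i 0i)))) (sign-odd (q β) q-β-odd)
             (sign-odd (z2 +₄ q β) (λ h → q-β-odd (even-z2+₄ (q β) h))) ⟩
      X +i (X +i ((-i X) +i ((-i X) +i 0i)))
        ≡⟨ cong (λ t → X +i (X +i ((-i X) +i t))) (+i-identityʳ (-i X)) ⟩
      X +i (X +i ((-i X) +i (-i X)))
        ≡⟨ +i-assoc X X _ ⟨
      (X +i X) +i ((-i X) +i (-i X))
        ≡⟨ cong ((X +i X) +i_) (-i-+i-comm X X) ⟩
      (X +i X) +i (-i (X +i X))
        ≡⟨ +i-inverseʳ (X +i X) ⟩
      0i ∎)
      where
      X : ℤi
      X = γ +i γ₃
      sign-odd : ∀ c → Odd c → sign c X ≡ -i X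
      sign-odd z1 _ = refl
      sign-odd z3 _ = refl
      sign-odd z0 odd = ⊥-elim (odd even0)
      sign-odd z2 odd = ⊥-elim (odd even2)
      even-z2+₄ : ∀ c → Even (z2 +₄ c) → Even c
      even-z2+₄ = decide (∀₄? λ c → even? (z2 +₄ c) →-dec even? c)

hyperbolic-pair : ∀ {n} {q : QuadFn n} → ContainsU q →
                  Σ (El n) λ u₁ → Σ (El n) λ u₂ → q u₁ ≡ z0 × q u₂ ≡ z0 × bil q u₁ u₂ ≡ z2
hyperbolic-pair {q = q} (k , qB , FB , φ) =
  inv φ e₁ , inv φ e₂ , trans (q-inv φ e₁) qB-0v , trans (q-inv φ e₂) qB-0v , bil-u₁u₂
  where
  open FQF FB using () renaming (q-0v to qB-0v)
  e₁ e₂ : El (2 + k)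
  e₁ = true ∷ false ∷ 0v
  e₂ = false ∷ true ∷ 0v
  bil-u₁u₂ : bil q (inv φ e₁) (inv φ e₂) ≡ z2
  bil-u₁u₂ = trans (bil-fun (isometry⁻¹ φ) e₁ e₂)
                   (cong₂ (λ s t → ((z2 +₄ s) -₄ t) -₄ t) (trans (cong qB (⊕-self 0v)) qB-0v) qB-0v)

dbl≡+ : ∀ m → dbl m ≡ m + m
dbl≡+ zero = refl
dbl≡+ (suc m) = cong suc (trans (cong suc (dbl≡+ m)) (sym (ℕ.+-suc m m)))

dbl-suc : ∀ m → dbl (suc m) ≡ dbl m + 2
dbl-suc zero = refl
dbl-suc (suc m) = cong (λ t → suc (suc t)) (dbl-suc m)

2^-square : ∀ m → 2 ^ m * 2 ^ m ≡ 2 ^ dbl m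
2^-square m = trans (sym (ℕ.^-distribˡ-+-* 2 m m)) (cong (2 ^_) (sym (dbl≡+ m)))

proposition4p4 : (n : ℕ) (q : QuadFn n) → IsFQF q → ContainsU q →
    (orb? : ∀ x y → Dec (Orbit q x y)) →
    ((Special q → (m : ℕ) → Isometry q (Upow m) →
        Σ ℕ λ s → (s * s ≡ 2 ^ n) × (G q orb? ≡ (+ s , + 0)))
     × (Special q → (m : ℕ) → Isometry q (Upow m ⊕q qV) →
        Σ ℕ λ s → (s * s ≡ 2 ^ n) × (G q orb? ≡ (- (+ s) , + 0)))
     × (¬ Special q → G q orb? ≡ (+ 0 , + 0)))
proposition4p4 n q F hasU orb? with hyperbolic-pair hasU
... | u₁ , u₂ , q-u₁ , q-u₂ , bil-u₁u₂ =
    (λ special m ψ → 2 ^ m ,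
       trans (2^-square m) (sym (size-isometry ψ)) ,
       trans (G-special special) (trans (γ-isometry ψ) (γ-Upow m)))
  , (λ special m ψ → 2 ^ suc m ,
       trans (2^-square (suc m)) (trans (cong (2 ^_) (dbl-suc m)) (sym (size-isometry ψ))) ,
       trans (G-special special) (trans (γ-isometry ψ) (γ-UpowV m)))
  , G-nonspecial
  where open Hyperbolic F orb? u₁ u₂ q-u₁ q-u₂ bil-u₁u₂
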